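{- Let $d \ge c \ge 2$ be integers with $d \neq 2$. Let $B$ be the (unsigned) non-backtracking matrix of the complete bipartite graph $K_{d,c}$, and put $s_c=\sqrt{c-1}$, $s_d=\sqrt{d-1}$, $\rho_1=s_cs_d$. Then the spectrum of $B$, as a multiset, consists of: - $\pm 1$, each with multiplicity $(c-1)(d-1)$; - $\pm i s_c$, each with multiplicity $d-1$; - $\pm i s_d$, each with multiplicity $c-1$; - $\pm s_c s_d$, each with multiplicity $1$. Here $i$ is the imaginary unit. In particular, the spectral radius is $\rho(B)=s_cs_d=\rho_1$.
   Context: $K_{d,c}$ is the complete bipartite graph with parts of sizes $d$ and $c$. Its non-backtracking matrix $B$ is indexed by directed edges: each undirected edge $\{x,y\}$ yields the two arcs $(x,y)$ and $(y,x)$. The entries are $B[(i,j),(k,\ell)]=1$ if $j=k$ and $i\neq \ell$, and $0$ otherwise. The spectrum is the multiset of roots of the characteristic polynomial, and $\rho$ denotes the spectral radius. -}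

module Defs where

open import Data.Nat as ℕ using (ℕ; zero; suc)
open import Data.Fin using (Fin; zero; suc; punchIn; remQuot; toℕ)
open import Data.Fin.Properties using () renaming (_≟_ to _≟F_)
open import Data.Integer using (ℤ; +_; _+_; _-_; _*_; -_; _^_)
open import Data.Product using (_×_; _,_; proj₁; proj₂)
open import Data.Sum using (_⊎_; inj₁; inj₂)
open import Data.Sum.Properties using (≡-dec)
open import Relation.Nullary using (yes; no)
open import Relation.Binary.Definitions using (DecidableEquality)

Matrix : ℕ → Set
Matrix n = Fin n → Fin n → ℤ

sumFin : {n : ℕ} → (Fin n → ℤ) → ℤ
sumFin {zero}  f = + 0
sumFin {suc n} f = f zero + sumFin (λ i → f (suc i))

sign : ℕ → ℤ
sign zero          = + 1
sign (suc zero)    = - (+ 1)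
sign (suc (suc k)) = sign k

det : {n : ℕ} → Matrix n → ℤ
det {zero}  M = + 1
det {suc n} M =
  sumFin (λ j → sign (toℕ j) * M zero j * det (λ r s → M (suc r) (punchIn j s)))

charMat : {n : ℕ} → ℤ → Matrix n → Matrix n
charMat x M i j with i ≟F j
... | yes _ = x - M i j
... | no  _ = - M i j

Vertex : ℕ → ℕ → Set
Vertex d c = Fin d ⊎ Fin c

_≟V_ : {d c : ℕ} → DecidableEquality (Vertex d c)
_≟V_ = ≡-dec _≟F_ _≟F_

-- Directed edges of K_{d,c}: there are 2dc of them, enumerated by Fin (2 * (d * c)).
-- Index k ↦ (t , a , b) with t : Fin 2, a : Fin d, b : Fin c, via remQuot;
-- t = 0 gives the arc (a , b) (left → right), t = 1 gives the arc (b , a).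
-- This is a bijection onto the set of arcs {(x,y) | {x,y} edge of K_{d,c}}.
arc : (d c : ℕ) → Fin (2 ℕ.* (d ℕ.* c)) → Vertex d c × Vertex d c
arc d c k with remQuot {2} (d ℕ.* c) k
... | t , e with remQuot {d} c e
... | a , b with t
... | zero  = inj₁ a , inj₂ b
... | suc _ = inj₂ b , inj₁ a

nbMatrix : (d c : ℕ) → Matrix (2 ℕ.* (d ℕ.* c))
nbMatrix d c e f with arc d c e | arc d c f
... | (i , j) | (k , l) with j ≟V k | i ≟V l
... | yes _ | no _  = + 1
... | yes _ | yes _ = + 0
... | no _  | _     = + 0

charPolyNB : (d c : ℕ) → ℤ → ℤ
charPolyNB d c x = det (charMat x (nbMatrix d c))

{-# OPTIONS --safe #-}
-- Order the arcs of K_{d,c} so that those leaving the d-side come first. Then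
-- B = [[0, P], [Q, 0]] with P = (J − I) ⊗ I and Q = I ⊗ (J − I), and multiplying x I − B on the
-- left by the upper triangular [[x I, P], [0, I]] gives x^{dc} det (x I − B) = x^{dc} det (x² I − PQ),
-- where PQ = (J − I) ⊗ (J − I). The matrix J − I of the complete graph K_m has the left eigenvectors
-- (1, …, 1) and e_a − e_0, with eigenvalues m − 1 and −1; they are the rows of F = U L with U upper
-- triangular and L lower unitriangular, and conjugating by F ⊗ F turns det (y I − (J − I) ⊗ (J − I))
-- into ∏_{a,b} (y − μ_a μ_b). Both sides of the resulting identity are polynomials in x, so it
-- extends from x ≠ 0 to x = 0.
--
-- Determinants are those of the Laplace expansion along the first row; the expansion is
-- multilinear and alternating in the rows, which gives det (S M) = (∏ S_ii) det M for triangular S.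
module Submission where

open import Defs
open import Algebra.Bundles using (Monoid)
open import Data.Nat as ℕ using (ℕ; zero; suc)
open import Data.Nat using (_≤_; _∸_) renaming (_*_ to _*ℕ_)
open import Data.Nat.Divisibility using (>⇒∤) renaming (_∣_ to _∣ℕ_)
import Data.Nat.Properties as ℕ
open import Data.Fin as Fin
  using (Fin; zero; suc; toℕ; punchIn; punchOut; _↑ˡ_; _↑ʳ_; splitAt; combine; quotient; remainder)
import Data.Fin.Properties as Fin
open import Data.Integer as ℤ using (ℤ; +_; +[1+_]; -[1+_]; 0ℤ; 1ℤ; -1ℤ; _+_; _*_; -_; _-_; _^_)
import Data.Integer.Properties as ℤ
open import Data.Integer.Divisibility.Signed using (_∣_; divides; ∣m∣n⇒∣m+n; ∣m∣n⇒∣m-n; ∣n⇒∣m*n; ∣m⇒∣m*n; ∣⇒∣ᵤ)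
open import Data.Integer.Tactic.RingSolver using (solve-∀)
open import Data.Bool using (true; false; if_then_else_)
open import Data.Fin.Permutation as Perm using (Permutation′; _⟨$⟩ʳ_; _⟨$⟩ˡ_)
open import Data.Product using (_×_; _,_; proj₁; proj₂)
open import Data.Sum using (_⊎_; inj₁; inj₂; [_,_]′)
open import Data.Vec.Functional using (updateAt; tail)
open import Data.Vec.Functional.Properties
  using (updateAt-updates; updateAt-minimal; updateAt-commutes; updateAt-id-local; map-updateAt)
open import Function using (_∘_; const)
open import Relation.Binary.Definitions using (tri<; tri≈; tri>)
open import Relation.Binary.PropositionalEquality
open import Relation.Nullary using (yes; no; does)
open import Relation.Nullary.Decidable using (dec-true; dec-false)
open import Relation.Nullary.Negation using (contradiction)

open import Algebra.Properties.Semiring.Sum ℤ.+-*-semiring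
  using (sum; sum-syntax; sum-cong-≗; sum-replicate-zero; sum-remove; ∑-distrib-+; ∑-comm;
         *-distribˡ-sum; *-distribʳ-sum)
open import Algebra.Properties.AbelianGroup ℤ.+-0-abelianGroup using (inverseʳ-unique)
open import Algebra.Properties.CommutativeMonoid.Sum ℤ.*-1-commutativeMonoid
  using () renaming (sum to ∏; sum-cong-≗ to ∏-cong; ∑-distrib-+ to ∏-distrib-*)

open ≡-Reasoning

private variable
  m n : ℕ

module _ {a ℓ} (M : Monoid a ℓ) where
  open Monoid M using (Carrier; _≈_; _∙_)
  private module M = Monoid M
  open import Algebra.Properties.Monoid.Sum M using () renaming (sum to fold)

  fold-↑ : ∀ m {n} (f : Fin (m ℕ.+ n) → Carrier) → fold f ≈ fold (f ∘ (_↑ˡ n)) ∙ fold (f ∘ (m ↑ʳ_))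
  fold-↑ zero    f = M.sym (M.identityˡ _)
  fold-↑ (suc m) f = M.trans (M.∙-congˡ (fold-↑ m (f ∘ suc))) (M.sym (M.assoc _ _ _))

  fold-combine : ∀ m {n} (f : Fin (m ℕ.* n) → Carrier) → fold f ≈ fold {m} (λ a → fold {n} (λ b → f (combine a b)))
  fold-combine zero    f = M.refl
  fold-combine (suc m) {n} f = M.trans (fold-↑ n f) (M.∙-congˡ (fold-combine m (f ∘ (n ↑ʳ_))))

sumFin≡sum : (f : Fin n → ℤ) → sumFin f ≡ sum f
sumFin≡sum {zero}  f = refl
sumFin≡sum {suc n} f = cong (λ s → f zero + s) (sumFin≡sum (f ∘ suc))

sum-zero : {f : Fin n → ℤ} → (∀ i → f i ≡ 0ℤ) → sum f ≡ 0ℤ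
sum-zero {n} f≡0 = trans (sum-cong-≗ f≡0) (sum-replicate-zero n)

sum-neg : (f : Fin n → ℤ) → ∑[ i < n ] (- f i) ≡ - sum f
sum-neg f = begin
  sum (λ i → - f i)      ≡⟨ sum-cong-≗ (λ i → sym (ℤ.-1*i≡-i (f i))) ⟩
  sum (λ i → -1ℤ * f i)  ≡⟨ *-distribˡ-sum -1ℤ f ⟨
  -1ℤ * sum f            ≡⟨ ℤ.-1*i≡-i (sum f) ⟩
  - sum f                ∎

sum-linear : ∀ a b (f g : Fin n → ℤ) → ∑[ i < n ] (a * f i + b * g i) ≡ a * sum f + b * sum g
sum-linear a b f g =
  trans (∑-distrib-+ (λ i → a * f i) (λ i → b * g i)) (sym (cong₂ _+_ (*-distribˡ-sum a f) (*-distribˡ-sum b g)))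

sum-const : ∀ n a → ∑[ i < n ] a ≡ + n * a
sum-const zero    a = sym (ℤ.*-zeroˡ a)
sum-const (suc n) a = trans (cong (λ s → a + s) (sum-const n a)) (distrib a (+ n))
  where
  distrib : ∀ a x → a + x * a ≡ (1ℤ + x) * a
  distrib = solve-∀

∏-const : ∀ n a → ∏ {n} (const a) ≡ a ^ n
∏-const zero    a = refl
∏-const (suc n) a = cong (a *_) (∏-const n a)

∏-updateAt : (f : Fin n → ℤ) (r : Fin n) (a : ℤ) → ∏ (updateAt f r (const a)) * f r ≡ a * ∏ f
∏-updateAt f zero    a = swap-last a (∏ (f ∘ suc)) (f zero)
  where
  swap-last : ∀ a p x → a * p * x ≡ a * (x * p)
  swap-last = solve-∀
∏-updateAt f (suc r) a = begin
  f zero * ∏ (updateAt (f ∘ suc) r (const a)) * f (suc r)    ≡⟨ ℤ.*-assoc (f zero) _ _ ⟩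
  f zero * (∏ (updateAt (f ∘ suc) r (const a)) * f (suc r))  ≡⟨ cong (f zero *_) (∏-updateAt (f ∘ suc) r a) ⟩
  f zero * (a * ∏ (f ∘ suc))                                ≡⟨ ℤ.*-comm (f zero) _ ⟩
  a * ∏ (f ∘ suc) * f zero                                  ≡⟨ ℤ.*-assoc a _ _ ⟩
  a * (∏ (f ∘ suc) * f zero)                                ≡⟨ cong (a *_) (ℤ.*-comm _ (f zero)) ⟩
  a * ∏ f                                                   ∎

∏-≢0 : (f : Fin n → ℤ) → (∀ i → f i ≢ 0ℤ) → ∏ f ≢ 0ℤ
∏-≢0 {suc n} f f≢0 ∏≡0 with ℤ.i*j≡0⇒i≡0∨j≡0 (f zero) ∏≡0
... | inj₁ f0≡0 = f≢0 zero f0≡0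
... | inj₂ ∏≡0′ = ∏-≢0 (f ∘ suc) (f≢0 ∘ suc) ∏≡0′

δ : Fin n → Fin n → ℤ
δ i j with i Fin.≟ j
... | yes _ = 1ℤ
... | no  _ = 0ℤ

δ-diag : (i : Fin n) → δ i i ≡ 1ℤ
δ-diag i with i Fin.≟ i
... | yes _   = refl
... | no  i≢i = contradiction refl i≢i

δ-≢ : {i j : Fin n} → i ≢ j → δ i j ≡ 0ℤ
δ-≢ {i = i} {j} i≢j with i Fin.≟ j
... | yes i≡j = contradiction i≡j i≢j
... | no  _   = refl

δ-injective : {f : Fin m → Fin n} → (∀ {i j} → f i ≡ f j → i ≡ j) → ∀ i j → δ (f i) (f j) ≡ δ i j
δ-injective f-inj i j with i Fin.≟ j
... | yes refl = δ-diag _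
... | no  i≢j  = δ-≢ (i≢j ∘ f-inj)

sum-δˡ : (i : Fin n) (f : Fin n → ℤ) → ∑[ k < n ] (δ i k * f k) ≡ f i
sum-δˡ {suc n} i f = begin
  ∑[ k < suc n ] (δ i k * f k)
    ≡⟨ sum-remove {i = i} (λ k → δ i k * f k) ⟩
  δ i i * f i + ∑[ k < n ] (δ i (punchIn i k) * f (punchIn i k))
    ≡⟨ cong₂ _+_ (cong (_* f i) (δ-diag i)) (sum-zero off-diagonal) ⟩
  1ℤ * f i + 0ℤ
    ≡⟨ trans (ℤ.+-identityʳ _) (ℤ.*-identityˡ _) ⟩
  f i ∎
  where
  off-diagonal : ∀ k → δ i (punchIn i k) * f (punchIn i k) ≡ 0ℤ
  off-diagonal k = trans (cong (_* f (punchIn i k)) (δ-≢ (Fin.punchInᵢ≢i i k ∘ sym))) (ℤ.*-zeroˡ (f (punchIn i k)))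

sum-δʳ : (j : Fin n) (f : Fin n → ℤ) → ∑[ k < n ] (f k * δ k j) ≡ f j
sum-δʳ {suc n} j f = begin
  ∑[ k < suc n ] (f k * δ k j)
    ≡⟨ sum-remove {i = j} (λ k → f k * δ k j) ⟩
  f j * δ j j + ∑[ k < n ] (f (punchIn j k) * δ (punchIn j k) j)
    ≡⟨ cong₂ _+_ (cong (f j *_) (δ-diag j)) (sum-zero off-diagonal) ⟩
  f j * 1ℤ + 0ℤ
    ≡⟨ trans (ℤ.+-identityʳ _) (ℤ.*-identityʳ _) ⟩
  f j ∎
  where
  off-diagonal : ∀ k → f (punchIn j k) * δ (punchIn j k) j ≡ 0ℤ
  off-diagonal k = trans (cong (f (punchIn j k) *_) (δ-≢ (Fin.punchInᵢ≢i j k))) (ℤ.*-zeroʳ (f (punchIn j k)))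

sum-δ-row : (i : Fin n) → ∑[ k < n ] δ i k ≡ 1ℤ
sum-δ-row i = trans (sum-cong-≗ (λ k → sym (ℤ.*-identityʳ (δ i k)))) (sum-δˡ i (const 1ℤ))

sum-δ-column : (j : Fin n) → ∑[ k < n ] δ k j ≡ 1ℤ
sum-δ-column j = trans (sum-cong-≗ (λ k → sym (ℤ.*-identityˡ (δ k j)))) (sum-δʳ j (const 1ℤ))

infix 4 _≋_
_≋_ : (A B : Fin m → Fin n → ℤ) → Set
A ≋ B = ∀ i j → A i j ≡ B i j

infixl 7 _∙_
_∙_ : ∀ {l} → (Fin l → Fin m → ℤ) → (Fin m → Fin n → ℤ) → Fin l → Fin n → ℤ
(A ∙ B) i j = sum (λ k → A i k * B k j)

∙-assoc : ∀ {l o} (A : Fin l → Fin m → ℤ) (B : Fin m → Fin n → ℤ) (C : Fin n → Fin o → ℤ) → A ∙ (B ∙ C) ≋ (A ∙ B) ∙ C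
∙-assoc {m} {n} A B C i j = begin
  ∑[ k < m ] (A i k * ∑[ l < n ] (B k l * C l j))
    ≡⟨ sum-cong-≗ (λ k → *-distribˡ-sum (A i k) (λ l → B k l * C l j)) ⟩
  ∑[ k < m ] ∑[ l < n ] (A i k * (B k l * C l j))
    ≡⟨ ∑-comm (λ k l → A i k * (B k l * C l j)) ⟩
  ∑[ l < n ] ∑[ k < m ] (A i k * (B k l * C l j))
    ≡⟨ sum-cong-≗ (λ l → trans (sum-cong-≗ (λ k → sym (ℤ.*-assoc (A i k) (B k l) (C l j))))
                               (sym (*-distribʳ-sum (C l j) (λ k → A i k * B k l)))) ⟩
  ∑[ l < n ] (∑[ k < m ] (A i k * B k l) * C l j) ∎

O : Fin m → Fin n → ℤ
O _ _ = 0ℤ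

infixl 6 _⊞_
_⊞_ : (A B : Fin m → Fin n → ℤ) → Fin m → Fin n → ℤ
(A ⊞ B) i j = A i j + B i j

O-∙ : (A : Fin m → Fin n → ℤ) → ∀ {l} i j → (O {l} ∙ A) i j ≡ 0ℤ
O-∙ A i j = sum-zero (λ k → ℤ.*-zeroˡ (A k j))

∙-neg : ∀ {l} (A : Fin l → Fin m → ℤ) (B : Fin m → Fin n → ℤ) → ∀ i j → (A ∙ (λ i j → - B i j)) i j ≡ - (A ∙ B) i j
∙-neg A B i j = trans (sum-cong-≗ (λ k → sym (ℤ.neg-distribʳ-* (A i k) (B k j)))) (sum-neg (λ k → A i k * B k j))

diag : (Fin n → ℤ) → Matrix n
diag μ i j = μ i * δ i j

scalar : ℤ → Matrix n
scalar x = diag (const x)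

diag-∙ : (μ : Fin n → ℤ) (A : Fin n → Fin m → ℤ) → ∀ i j → (diag μ ∙ A) i j ≡ μ i * A i j
diag-∙ μ A i j = trans (sum-cong-≗ (λ k → commute (μ i) (δ i k) (A k j))) (sum-δˡ i (λ k → μ i * A k j))
  where
  commute : ∀ x d a → x * d * a ≡ d * (x * a)
  commute = solve-∀

∙-diag : (μ : Fin n → ℤ) (A : Fin m → Fin n → ℤ) → ∀ i j → (A ∙ diag μ) i j ≡ A i j * μ j
∙-diag μ A i j = trans (sum-cong-≗ (λ k → sym (ℤ.*-assoc (A i k) (μ k) (δ k j)))) (sum-δʳ j (λ k → A i k * μ k))

charMat-≡ : ∀ x (M : Matrix n) i j → charMat x M i j ≡ x * δ i j - M i j
charMat-≡ x M i j with i Fin.≟ j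
... | yes _ = cong (_- M i j) (sym (ℤ.*-identityʳ x))
... | no  _ = sym (trans (cong (_- M i j) (ℤ.*-zeroʳ x)) (ℤ.+-identityˡ _))

charMat-cong : (x : ℤ) {M N : Matrix n} → M ≋ N → charMat x M ≋ charMat x N
charMat-cong x {M} {N} M≋N i j =
  trans (charMat-≡ x M i j) (trans (cong (λ z → x * δ i j - z) (M≋N i j)) (sym (charMat-≡ x N i j)))

-- Laplace expansion and linearity in the rows

minor : Matrix (suc n) → Fin (suc n) → Matrix n
minor M j r s = M (suc r) (punchIn j s)

det-expand : (M : Matrix (suc n)) → det M ≡ ∑[ j < suc n ] (sign (toℕ j) * M zero j * det (minor M j))
det-expand M = sumFin≡sum (λ j → sign (toℕ j) * M zero j * det (minor M j))

det-cong : {M N : Matrix n} → M ≋ N → det M ≡ det N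
det-cong {zero}  _   = refl
det-cong {suc n} {M} {N} M≋N = begin
  det M  ≡⟨ det-expand M ⟩
  _      ≡⟨ sum-cong-≗ (λ j → cong₂ (λ a b → sign (toℕ j) * a * b) (M≋N zero j)
                                     (det-cong (λ r s → M≋N (suc r) (punchIn j s)))) ⟩
  _      ≡⟨ det-expand N ⟨
  det N  ∎

det-cong-rows : {M N : Matrix n} → (∀ i → M i ≡ N i) → det M ≡ det N
det-cong-rows M≗N = det-cong (λ i → cong-app (M≗N i))

infixl 6 _[_]≔_
_[_]≔_ : Matrix n → Fin n → (Fin n → ℤ) → Matrix n
M [ r ]≔ u = updateAt M r (const u)

[]≔-≋ : (M : Matrix n) (r : Fin n) {u v : Fin n → ℤ} → (∀ j → u j ≡ v j) → M [ r ]≔ u ≋ M [ r ]≔ v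
[]≔-≋ M r u≗v i j with i Fin.≟ r
... | yes refl = trans (cong-app (updateAt-updates i M) j) (trans (u≗v j) (sym (cong-app (updateAt-updates i M) j)))
... | no  i≢r  = trans (cong-app (updateAt-minimal i r M i≢r) j) (sym (cong-app (updateAt-minimal i r M i≢r) j))

[]≔-cong : {M N : Matrix n} (r : Fin n) (u : Fin n → ℤ) → (∀ i → M i ≡ N i) → ∀ i → (M [ r ]≔ u) i ≡ (N [ r ]≔ u) i
[]≔-cong {M = M} {N} r u M≗N i with i Fin.≟ r
... | yes refl = trans (updateAt-updates i M) (sym (updateAt-updates i N))
... | no  i≢r  = trans (updateAt-minimal i r M i≢r) (trans (M≗N i) (sym (updateAt-minimal i r N i≢r)))

minor-[]≔ : (M : Matrix (suc n)) (r : Fin n) (u : Fin (suc n) → ℤ) (j : Fin (suc n)) →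
            ∀ i → minor (M [ suc r ]≔ u) j i ≡ (minor M j [ r ]≔ (u ∘ punchIn j)) i
minor-[]≔ M r u j = map-updateAt {f = _∘ punchIn j} (λ _ → refl) (tail M) r

det-row-linear : (M : Matrix n) (r : Fin n) (a b : ℤ) (u v : Fin n → ℤ) →
                 det (M [ r ]≔ (λ j → a * u j + b * v j)) ≡ a * det (M [ r ]≔ u) + b * det (M [ r ]≔ v)
det-row-linear {suc n} M zero a b u v = begin
  det (M [ zero ]≔ w)
    ≡⟨ det-expand (M [ zero ]≔ w) ⟩
  ∑[ j < suc n ] (sign (toℕ j) * w j * D j)
    ≡⟨ sum-cong-≗ (λ j → distrib a b (sign (toℕ j)) (D j) (u j) (v j)) ⟩
  ∑[ j < suc n ] (a * (sign (toℕ j) * u j * D j) + b * (sign (toℕ j) * v j * D j))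
    ≡⟨ sum-linear a b (λ j → sign (toℕ j) * u j * D j) (λ j → sign (toℕ j) * v j * D j) ⟩
  a * _ + b * _
    ≡⟨ cong₂ (λ p q → a * p + b * q) (det-expand (M [ zero ]≔ u)) (det-expand (M [ zero ]≔ v)) ⟨
  a * det (M [ zero ]≔ u) + b * det (M [ zero ]≔ v) ∎
  where
  w : Fin (suc n) → ℤ
  w j = a * u j + b * v j
  D : Fin (suc n) → ℤ
  D j = det (minor M j)
  distrib : ∀ a b s t x y → s * (a * x + b * y) * t ≡ a * (s * x * t) + b * (s * y * t)
  distrib = solve-∀
det-row-linear {suc n} M (suc r) a b u v = begin
  det (M [ suc r ]≔ w)
    ≡⟨ det-expand (M [ suc r ]≔ w) ⟩
  ∑[ j < suc n ] (c j * det (minor (M [ suc r ]≔ w) j))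
    ≡⟨ sum-cong-≗ expand-minor ⟩
  ∑[ j < suc n ] (a * (c j * det (minor (M [ suc r ]≔ u) j)) + b * (c j * det (minor (M [ suc r ]≔ v) j)))
    ≡⟨ sum-linear a b (λ j → c j * det (minor (M [ suc r ]≔ u) j)) (λ j → c j * det (minor (M [ suc r ]≔ v) j)) ⟩
  a * _ + b * _
    ≡⟨ cong₂ (λ p q → a * p + b * q) (det-expand (M [ suc r ]≔ u)) (det-expand (M [ suc r ]≔ v)) ⟨
  a * det (M [ suc r ]≔ u) + b * det (M [ suc r ]≔ v) ∎
  where
  w : Fin (suc n) → ℤ
  w j = a * u j + b * v j
  c : Fin (suc n) → ℤ
  c j = sign (toℕ j) * M zero j
  distrib : ∀ a b s x y → s * (a * x + b * y) ≡ a * (s * x) + b * (s * y)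
  distrib = solve-∀
  expand-minor : ∀ j → c j * det (minor (M [ suc r ]≔ w) j)
                     ≡ a * (c j * det (minor (M [ suc r ]≔ u) j)) + b * (c j * det (minor (M [ suc r ]≔ v) j))
  expand-minor j = begin
    c j * det (minor (M [ suc r ]≔ w) j)
      ≡⟨ cong (c j *_) (det-cong-rows (minor-[]≔ M r w j)) ⟩
    c j * det (minor M j [ r ]≔ (w ∘ punchIn j))
      ≡⟨ cong (c j *_) (det-row-linear (minor M j) r a b _ _) ⟩
    c j * (a * det (minor M j [ r ]≔ (u ∘ punchIn j)) + b * det (minor M j [ r ]≔ (v ∘ punchIn j)))
      ≡⟨ distrib a b (c j) _ _ ⟩
    a * (c j * det (minor M j [ r ]≔ (u ∘ punchIn j))) + b * (c j * det (minor M j [ r ]≔ (v ∘ punchIn j)))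
      ≡⟨ cong₂ (λ p q → a * (c j * p) + b * (c j * q)) (det-cong-rows (minor-[]≔ M r u j)) (det-cong-rows (minor-[]≔ M r v j)) ⟨
    a * (c j * det (minor (M [ suc r ]≔ u) j)) + b * (c j * det (minor (M [ suc r ]≔ v) j))
      ∎

det-row-+ : (M : Matrix n) (r : Fin n) (u v : Fin n → ℤ) →
            det (M [ r ]≔ (λ j → u j + v j)) ≡ det (M [ r ]≔ u) + det (M [ r ]≔ v)
det-row-+ M r u v = begin
  det (M [ r ]≔ (λ j → u j + v j))
    ≡⟨ det-cong ([]≔-≋ M r (λ j → sym (cong₂ _+_ (ℤ.*-identityˡ (u j)) (ℤ.*-identityˡ (v j))))) ⟩
  det (M [ r ]≔ (λ j → 1ℤ * u j + 1ℤ * v j))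
    ≡⟨ det-row-linear M r 1ℤ 1ℤ u v ⟩
  1ℤ * det (M [ r ]≔ u) + 1ℤ * det (M [ r ]≔ v)
    ≡⟨ cong₂ _+_ (ℤ.*-identityˡ (det (M [ r ]≔ u))) (ℤ.*-identityˡ (det (M [ r ]≔ v))) ⟩
  det (M [ r ]≔ u) + det (M [ r ]≔ v) ∎

det-row-∑ : (M : Matrix n) (r : Fin n) (c : Fin m → ℤ) (u : Fin m → Fin n → ℤ) →
            det (M [ r ]≔ (λ j → ∑[ k < m ] (c k * u k j))) ≡ ∑[ k < m ] (c k * det (M [ r ]≔ u k))
det-row-∑ {m = zero} M r c u = begin
  det (M [ r ]≔ const 0ℤ)                             ≡⟨ det-cong ([]≔-≋ M r (λ _ → refl)) ⟩
  det (M [ r ]≔ (λ j → 0ℤ * 0ℤ + 0ℤ * 0ℤ))            ≡⟨ det-row-linear M r 0ℤ 0ℤ (const 0ℤ) (const 0ℤ) ⟩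
  0ℤ * det (M [ r ]≔ const 0ℤ) + 0ℤ * det (M [ r ]≔ const 0ℤ)  ≡⟨⟩
  0ℤ                                                  ∎
det-row-∑ {m = suc m} M r c u = begin
  det (M [ r ]≔ (λ j → c zero * u zero j + rest j))
    ≡⟨ det-cong ([]≔-≋ M r (λ j → cong (λ s → c zero * u zero j + s) (sym (ℤ.*-identityˡ (rest j))))) ⟩
  det (M [ r ]≔ (λ j → c zero * u zero j + 1ℤ * rest j))
    ≡⟨ det-row-linear M r (c zero) 1ℤ (u zero) rest ⟩
  c zero * det (M [ r ]≔ u zero) + 1ℤ * det (M [ r ]≔ rest)
    ≡⟨ cong (λ s → c zero * det (M [ r ]≔ u zero) + s) (trans (ℤ.*-identityˡ _) (det-row-∑ M r (c ∘ suc) (u ∘ suc))) ⟩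
  ∑[ k < suc m ] (c k * det (M [ r ]≔ u k))
    ∎
  where
  rest : Fin _ → ℤ
  rest j = ∑[ k < m ] (c (suc k) * u (suc k) j)

-- Alternation

x≡-x⇒x≡0 : ∀ x → x ≡ - x → x ≡ 0ℤ
x≡-x⇒x≡0 (+ zero)  _  = refl
x≡-x⇒x≡0 +[1+ _ ] ()
x≡-x⇒x≡0 -[1+ _ ] ()

sign-suc : ∀ k → sign (suc k) ≡ - sign k
sign-suc zero    = refl
sign-suc (suc k) = begin
  sign k          ≡⟨ ℤ.neg-involutive (sign k) ⟨
  - - sign k      ≡⟨ cong -_ (sign-suc k) ⟨
  - sign (suc k)  ∎

sign-suc-* : ∀ a b → sign (suc a) * sign (suc b) ≡ sign a * sign b
sign-suc-* a b = trans (cong₂ _*_ (sign-suc a) (sign-suc b)) (neg-*-neg (sign a) (sign b))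
  where
  neg-*-neg : ∀ x y → - x * - y ≡ x * y
  neg-*-neg = solve-∀

sign-punchOut : (j l : Fin (suc n)) (j≢l : j ≢ l) (l≢j : l ≢ j) →
                sign (toℕ j) * sign (toℕ (punchOut j≢l)) ≡ - (sign (toℕ l) * sign (toℕ (punchOut l≢j)))
sign-punchOut zero zero j≢l _ = contradiction refl j≢l
sign-punchOut {suc n} zero (suc l) _ _ = begin
  1ℤ * sign (toℕ l)          ≡⟨ ℤ.*-identityˡ _ ⟩
  sign (toℕ l)               ≡⟨ ℤ.neg-involutive _ ⟨
  - - sign (toℕ l)           ≡⟨ cong -_ (trans (ℤ.*-identityʳ _) (sign-suc (toℕ l))) ⟨
  - (sign (suc (toℕ l)) * 1ℤ) ∎
sign-punchOut {suc n} (suc j) zero _ _ = begin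
  sign (suc (toℕ j)) * 1ℤ    ≡⟨ trans (ℤ.*-identityʳ _) (sign-suc (toℕ j)) ⟩
  - sign (toℕ j)             ≡⟨ cong -_ (ℤ.*-identityˡ _) ⟨
  - (1ℤ * sign (toℕ j))      ∎
sign-punchOut {suc n} (suc j) (suc l) j≢l l≢j = begin
  sign (suc (toℕ j)) * sign (suc (toℕ (punchOut (j≢l ∘ cong suc))))
    ≡⟨ sign-suc-* (toℕ j) (toℕ (punchOut (j≢l ∘ cong suc))) ⟩
  sign (toℕ j) * sign (toℕ (punchOut (j≢l ∘ cong suc)))
    ≡⟨ sign-punchOut j l _ _ ⟩
  - (sign (toℕ l) * sign (toℕ (punchOut (l≢j ∘ cong suc))))
    ≡⟨ cong -_ (sign-suc-* (toℕ l) (toℕ (punchOut (l≢j ∘ cong suc)))) ⟨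
  - (sign (suc (toℕ l)) * sign (suc (toℕ (punchOut (l≢j ∘ cong suc))))) ∎

punchIn-punchOut-comm : (j l : Fin (suc (suc n))) (j≢l : j ≢ l) (l≢j : l ≢ j) (s : Fin n) →
                        punchIn j (punchIn (punchOut j≢l) s) ≡ punchIn l (punchIn (punchOut l≢j) s)
punchIn-punchOut-comm zero    zero    j≢l _ _ = contradiction refl j≢l
punchIn-punchOut-comm zero    (suc l) _   _ _ = refl
punchIn-punchOut-comm (suc j) zero    _   _ _ = refl
punchIn-punchOut-comm {suc n} (suc j) (suc l) _ _ zero = refl
punchIn-punchOut-comm {suc n} (suc j) (suc l) j≢l l≢j (suc s) =
  cong suc (punchIn-punchOut-comm j l (j≢l ∘ cong suc) (l≢j ∘ cong suc) s)

-- Expanding along the first two rows pairs the terms for columns (j, l) and (l, j) with opposite signs.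
det-rows01-equal : (M : Matrix (suc (suc n))) → M zero ≡ M (suc zero) → det M ≡ 0ℤ
det-rows01-equal {n} M row₀≡row₁ = x≡-x⇒x≡0 (det M) (begin
  det M
    ≡⟨ det-double-expansion ⟩
  ∑[ j < suc (suc n) ] ∑[ l < suc (suc n) ] G j l
    ≡⟨ ∑-comm G ⟩
  ∑[ l < suc (suc n) ] ∑[ j < suc (suc n) ] G j l
    ≡⟨ sum-cong-≗ (λ l → trans (sum-cong-≗ (λ j → G-antisym j l)) (sum-neg (G l))) ⟩
  ∑[ l < suc (suc n) ] (- sum (G l))
    ≡⟨ sum-neg (λ l → sum (G l)) ⟩
  - ∑[ j < suc (suc n) ] ∑[ l < suc (suc n) ] G j l
    ≡⟨ cong -_ det-double-expansion ⟨
  - det M                                       ∎)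
  where
  u : Fin (suc (suc n)) → ℤ
  u = M zero

  minor₂ : Fin (suc (suc n)) → Fin (suc n) → ℤ
  minor₂ j t = det (λ r s → M (suc (suc r)) (punchIn j (punchIn t s)))

  term : (j l : Fin (suc (suc n))) → Fin (suc n) → ℤ
  term j l t = sign (toℕ j) * sign (toℕ t) * (u j * u l * minor₂ j t)

  G : Fin (suc (suc n)) → Fin (suc (suc n)) → ℤ
  G j l with j Fin.≟ l
  ... | yes _   = 0ℤ
  ... | no  j≢l = term j l (punchOut j≢l)

  G-diag : ∀ j → G j j ≡ 0ℤ
  G-diag j with j Fin.≟ j
  ... | yes _   = refl
  ... | no  j≢j = contradiction refl j≢j

  G-≢ : ∀ {j l} (j≢l : j ≢ l) → G j l ≡ term j l (punchOut j≢l)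
  G-≢ {j} {l} j≢l with j Fin.≟ l
  ... | yes j≡l = contradiction j≡l j≢l
  ... | no  _   = cong (term j l) (Fin.punchOut-cong j refl)

  term-antisym : ∀ j l (j≢l : j ≢ l) (l≢j : l ≢ j) → term j l (punchOut j≢l) ≡ - term l j (punchOut l≢j)
  term-antisym j l j≢l l≢j = begin
    term j l (punchOut j≢l)
      ≡⟨ cong₂ _*_ (sign-punchOut j l j≢l l≢j)
                   (cong₂ _*_ (ℤ.*-comm (u j) (u l))
                              (det-cong (λ r s → cong (M (suc (suc r))) (punchIn-punchOut-comm j l j≢l l≢j s)))) ⟩
    - (sign (toℕ l) * sign (toℕ (punchOut l≢j))) * (u l * u j * minor₂ l (punchOut l≢j))
      ≡⟨ ℤ.neg-distribˡ-* (sign (toℕ l) * sign (toℕ (punchOut l≢j))) (u l * u j * minor₂ l (punchOut l≢j)) ⟨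
    - term l j (punchOut l≢j)
      ∎

  G-antisym : ∀ j l → G j l ≡ - G l j
  G-antisym j l with j Fin.≟ l | l Fin.≟ j
  ... | yes _   | yes _   = refl
  ... | yes j≡l | no  l≢j = contradiction (sym j≡l) l≢j
  ... | no  j≢l | yes l≡j = contradiction (sym l≡j) j≢l
  ... | no  j≢l | no  l≢j = term-antisym j l j≢l l≢j

  G-punchIn : ∀ j k → G j (punchIn j k)
                    ≡ sign (toℕ j) * u j * (sign (toℕ k) * minor M j zero k * det (minor (minor M j) k))
  G-punchIn j k = begin
    G j (punchIn j k)
      ≡⟨ G-≢ (Fin.punchInᵢ≢i j k ∘ sym) ⟩
    term j (punchIn j k) (punchOut (Fin.punchInᵢ≢i j k ∘ sym))
      ≡⟨ cong (term j (punchIn j k)) (Fin.punchOut-punchIn j) ⟩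
    term j (punchIn j k) k
      ≡⟨ rearrange (sign (toℕ j)) (sign (toℕ k)) (u j) (u (punchIn j k)) _ ⟩
    sign (toℕ j) * u j * (sign (toℕ k) * u (punchIn j k) * det (minor (minor M j) k))
      ≡⟨ cong (λ a → sign (toℕ j) * u j * (sign (toℕ k) * a * det (minor (minor M j) k))) (cong-app row₀≡row₁ (punchIn j k)) ⟩
    sign (toℕ j) * u j * (sign (toℕ k) * minor M j zero k * det (minor (minor M j) k))
      ∎
    where
    rearrange : ∀ s t a b D → s * t * (a * b * D) ≡ s * a * (t * b * D)
    rearrange = solve-∀

  det-double-expansion : det M ≡ ∑[ j < suc (suc n) ] ∑[ l < suc (suc n) ] G j l
  det-double-expansion = trans (det-expand M) (sum-cong-≗ expand-minor)
    where
    expand-minor : ∀ j → sign (toℕ j) * u j * det (minor M j) ≡ sum (G j)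
    expand-minor j = begin
      sign (toℕ j) * u j * det (minor M j)
        ≡⟨ cong (sign (toℕ j) * u j *_) (det-expand (minor M j)) ⟩
      sign (toℕ j) * u j * ∑[ k < suc n ] (sign (toℕ k) * minor M j zero k * det (minor (minor M j) k))
        ≡⟨ *-distribˡ-sum (sign (toℕ j) * u j) (λ k → sign (toℕ k) * minor M j zero k * det (minor (minor M j) k)) ⟩
      ∑[ k < suc n ] (sign (toℕ j) * u j * (sign (toℕ k) * minor M j zero k * det (minor (minor M j) k)))
        ≡⟨ sum-cong-≗ (λ k → G-punchIn j k) ⟨
      ∑[ k < suc n ] G j (punchIn j k)
        ≡⟨ trans (cong (_+ ∑[ k < suc n ] G j (punchIn j k)) (G-diag j)) (ℤ.+-identityˡ _) ⟨
      G j j + ∑[ k < suc n ] G j (punchIn j k)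
        ≡⟨ sum-remove {i = j} (G j) ⟨
      sum (G j)
        ∎

Alternating : ℕ → Set
Alternating n = (M : Matrix n) {i j : Fin n} → i ≢ j → M i ≡ M j → det M ≡ 0ℤ

swapRows : Matrix n → Fin n → Fin n → Matrix n
swapRows M p q = M [ p ]≔ M q [ q ]≔ M p

-- An alternating function of two rows that is additive in each of them is antisymmetric.
det-swapRows : Alternating n → (M : Matrix n) {p q : Fin n} → p ≢ q → det (swapRows M p q) ≡ - det M
det-swapRows alt M {p} {q} p≢q = begin
  D (M q) (M p)    ≡⟨ inverseʳ-unique (D (M p) (M q)) (D (M q) (M p)) (D-antisym (M p) (M q)) ⟩
  - D (M p) (M q)  ≡⟨ cong -_ D-id ⟩
  - det M          ∎
  where
  D : (Fin _ → ℤ) → (Fin _ → ℤ) → ℤ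
  D u v = det (M [ p ]≔ u [ q ]≔ v)

  _⊕_ : (Fin _ → ℤ) → (Fin _ → ℤ) → Fin _ → ℤ
  (u ⊕ v) j = u j + v j

  commute : ∀ u v → det (M [ p ]≔ u [ q ]≔ v) ≡ det (M [ q ]≔ v [ p ]≔ u)
  commute u v = det-cong-rows (updateAt-commutes q p (p≢q ∘ sym) M)

  D-+ˡ : ∀ u u′ v → D (u ⊕ u′) v ≡ D u v + D u′ v
  D-+ˡ u u′ v = begin
    D (u ⊕ u′) v                                            ≡⟨ commute (u ⊕ u′) v ⟩
    det (M [ q ]≔ v [ p ]≔ (u ⊕ u′))                         ≡⟨ det-row-+ (M [ q ]≔ v) p u u′ ⟩
    det (M [ q ]≔ v [ p ]≔ u) + det (M [ q ]≔ v [ p ]≔ u′)  ≡⟨ cong₂ _+_ (commute u v) (commute u′ v) ⟨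
    D u v + D u′ v                                          ∎

  D-+ʳ : ∀ u v v′ → D u (v ⊕ v′) ≡ D u v + D u v′
  D-+ʳ u = det-row-+ (M [ p ]≔ u) q

  D-diag : ∀ w → D w w ≡ 0ℤ
  D-diag w = alt (M [ p ]≔ w [ q ]≔ w) p≢q
    (trans (updateAt-minimal p q (M [ p ]≔ w) p≢q) (trans (updateAt-updates p M) (sym (updateAt-updates q (M [ p ]≔ w)))))

  D-id : D (M p) (M q) ≡ det M
  D-id = det-cong-rows (λ i → trans (updateAt-id-local q (M [ p ]≔ M p) (sym (updateAt-minimal q p M (p≢q ∘ sym))) i)
                                    (updateAt-id-local p M refl i))

  D-antisym : ∀ u v → D u v + D v u ≡ 0ℤ
  D-antisym u v = begin
    D u v + D v u
      ≡⟨ cong₂ _+_ (trans (cong (_+ D u v) (D-diag u)) (ℤ.+-identityˡ (D u v)))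
                   (trans (cong (λ x → D v u + x) (D-diag v)) (ℤ.+-identityʳ (D v u))) ⟨
    (D u u + D u v) + (D v u + D v v)
      ≡⟨ cong₂ _+_ (D-+ʳ u u v) (D-+ʳ v u v) ⟨
    D u (u ⊕ v) + D v (u ⊕ v)
      ≡⟨ D-+ˡ u v (u ⊕ v) ⟨
    D (u ⊕ v) (u ⊕ v)
      ≡⟨ D-diag (u ⊕ v) ⟩
    0ℤ ∎

minor-swapRows : (M : Matrix (suc n)) (p q : Fin n) (k : Fin (suc n)) →
                 ∀ i → minor (swapRows M (suc p) (suc q)) k i ≡ swapRows (minor M k) p q i
minor-swapRows M p q k i =
  trans (minor-[]≔ (M [ suc p ]≔ M (suc q)) q (M (suc p)) k i)
        ([]≔-cong q (M (suc p) ∘ punchIn k) (minor-[]≔ M p (M (suc q)) k) i)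

det-swapRows-suc : Alternating n → (M : Matrix (suc n)) {p q : Fin n} → p ≢ q →
                   det (swapRows M (suc p) (suc q)) ≡ - det M
det-swapRows-suc {n} alt M {p} {q} p≢q = begin
  det (swapRows M (suc p) (suc q))                         ≡⟨ det-expand (swapRows M (suc p) (suc q)) ⟩
  ∑[ k < suc n ] (c k * det (minor (swapRows M (suc p) (suc q)) k))  ≡⟨ sum-cong-≗ swap-minor ⟩
  ∑[ k < suc n ] (- (c k * det (minor M k)))               ≡⟨ sum-neg (λ k → c k * det (minor M k)) ⟩
  - ∑[ k < suc n ] (c k * det (minor M k))                 ≡⟨ cong -_ (det-expand M) ⟨
  - det M                                                  ∎
  where
  c : Fin (suc n) → ℤ
  c k = sign (toℕ k) * M zero k
  swap-minor : ∀ k → c k * det (minor (swapRows M (suc p) (suc q)) k) ≡ - (c k * det (minor M k))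
  swap-minor k = begin
    c k * det (minor (swapRows M (suc p) (suc q)) k)
      ≡⟨ cong (c k *_) (det-cong-rows (minor-swapRows M p q k)) ⟩
    c k * det (swapRows (minor M k) p q)
      ≡⟨ cong (c k *_) (det-swapRows alt (minor M k) p≢q) ⟩
    c k * - det (minor M k)
      ≡⟨ ℤ.neg-distribʳ-* (c k) _ ⟨
    - (c k * det (minor M k)) ∎

det-alternating : ∀ n → Alternating n

det-row₀-repeated : ∀ n (M : Matrix (suc n)) (j : Fin n) → M zero ≡ M (suc j) → det M ≡ 0ℤ

det-alternating zero    M {()}
det-alternating (suc n) M {zero}  {zero}  0≢0 _  = contradiction refl 0≢0
det-alternating (suc n) M {zero}  {suc j} _   eq = det-row₀-repeated n M j eq
det-alternating (suc n) M {suc i} {zero}  _   eq = det-row₀-repeated n M i (sym eq)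
det-alternating (suc n) M {suc i} {suc j} i≢j eq = trans (det-expand M) (sum-zero minor-vanishes)
  where
  minor-vanishes : ∀ k → sign (toℕ k) * M zero k * det (minor M k) ≡ 0ℤ
  minor-vanishes k = trans (cong (sign (toℕ k) * M zero k *_)
                                 (det-alternating n (minor M k) (i≢j ∘ cong suc) (cong (_∘ punchIn k) eq)))
                           (ℤ.*-zeroʳ (sign (toℕ k) * M zero k))

det-row₀-repeated zero    M ()
det-row₀-repeated (suc n) M zero    eq = det-rows01-equal M eq
-- Swapping rows 1 and j + 2 brings the repeated row next to row 0.
det-row₀-repeated (suc n) M (suc j) eq = ℤ.neg-injective (begin
  - det M
    ≡⟨ det-swapRows-suc (det-alternating (suc n)) M {zero} {suc j} (λ ()) ⟨
  det (swapRows M (suc zero) (suc (suc j)))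
    ≡⟨ det-rows01-equal (swapRows M (suc zero) (suc (suc j))) eq ⟩
  0ℤ                                     ∎)

det-row-combination : (M : Matrix n) (r : Fin n) (c : Fin n → ℤ) →
                      det (M [ r ]≔ (λ j → ∑[ k < n ] (c k * M k j))) ≡ c r * det M
det-row-combination {suc n} M r c = begin
  det (M [ r ]≔ (λ j → ∑[ k < suc n ] (c k * M k j)))
    ≡⟨ det-row-∑ M r c M ⟩
  ∑[ k < suc n ] (c k * det (M [ r ]≔ M k))
    ≡⟨ sum-remove {i = r} (λ k → c k * det (M [ r ]≔ M k)) ⟩
  c r * det (M [ r ]≔ M r) + ∑[ k < n ] (c (punchIn r k) * det (M [ r ]≔ M (punchIn r k)))
    ≡⟨ cong₂ _+_ (cong (c r *_) (det-cong-rows (updateAt-id-local r M refl))) (sum-zero repeated-row) ⟩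
  c r * det M + 0ℤ
    ≡⟨ ℤ.+-identityʳ _ ⟩
  c r * det M
    ∎
  where
  repeated-row : ∀ k → c (punchIn r k) * det (M [ r ]≔ M (punchIn r k)) ≡ 0ℤ
  repeated-row k = trans (cong (c (punchIn r k) *_)
                               (det-alternating (suc n) (M [ r ]≔ M (punchIn r k)) (Fin.punchInᵢ≢i r k ∘ sym)
                                 (trans (updateAt-updates r M) (sym (updateAt-minimal _ r M (Fin.punchInᵢ≢i r k))))))
                         (ℤ.*-zeroʳ (c (punchIn r k)))

-- Triangular matrices

UpperTriangular : Matrix n → Set
UpperTriangular S = ∀ i k → k Fin.< i → S i k ≡ 0ℤ

LowerTriangular : Matrix n → Set
LowerTriangular S = ∀ i k → i Fin.< k → S i k ≡ 0ℤ

det-lower : (L : Matrix n) → LowerTriangular L → det L ≡ ∏ (λ i → L i i)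
det-lower {zero}  L _       = refl
det-lower {suc n} L L-lower = begin
  det L
    ≡⟨ det-expand L ⟩
  1ℤ * L zero zero * det (minor L zero) + ∑[ j < n ] (sign (toℕ (suc j)) * L zero (suc j) * det (minor L (suc j)))
    ≡⟨ cong₂ _+_ (cong (_* det (minor L zero)) (ℤ.*-identityˡ (L zero zero))) (sum-zero above-diagonal) ⟩
  L zero zero * det (minor L zero) + 0ℤ
    ≡⟨ ℤ.+-identityʳ _ ⟩
  L zero zero * det (minor L zero)
    ≡⟨ cong (L zero zero *_) (det-lower (minor L zero) (λ i k i<k → L-lower (suc i) (suc k) (ℕ.s<s i<k))) ⟩
  ∏ (λ i → L i i)
    ∎
  where
  above-diagonal : ∀ j → sign (toℕ (suc j)) * L zero (suc j) * det (minor L (suc j)) ≡ 0ℤ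
  above-diagonal j = begin
    sign (toℕ (suc j)) * L zero (suc j) * det (minor L (suc j))
      ≡⟨ cong (λ a → sign (toℕ (suc j)) * a * det (minor L (suc j))) (L-lower zero (suc j) ℕ.z<s) ⟩
    sign (toℕ (suc j)) * 0ℤ * det (minor L (suc j))
      ≡⟨ cong (_* det (minor L (suc j))) (ℤ.*-zeroʳ (sign (toℕ (suc j)))) ⟩
    0ℤ * det (minor L (suc j))
      ≡⟨⟩
    0ℤ ∎

diag-upper : (μ : Fin n → ℤ) → UpperTriangular (diag μ)
diag-upper μ i k k<i = trans (cong (μ i *_) (δ-≢ (Fin.<⇒≢ k<i ∘ sym))) (ℤ.*-zeroʳ (μ i))

diag-lower : (μ : Fin n → ℤ) → LowerTriangular (diag μ)
diag-lower μ i k i<k = trans (cong (μ i *_) (δ-≢ (Fin.<⇒≢ i<k))) (ℤ.*-zeroʳ (μ i))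

∏-diag : (μ : Fin n → ℤ) → ∏ (λ i → diag μ i i) ≡ ∏ μ
∏-diag μ = ∏-cong (λ i → trans (cong (μ i *_) (δ-diag i)) (ℤ.*-identityʳ (μ i)))

det-diag : (μ : Fin n → ℤ) → det (diag μ) ≡ ∏ μ
det-diag μ = trans (det-lower (diag μ) (diag-lower μ)) (∏-diag μ)

det-scalar : (x : ℤ) → det (scalar {n} x) ≡ x ^ n
det-scalar {n} x = trans (det-diag {n} (const x)) (∏-const n x)

<?-suc : ∀ {m t} → m ≢ t → does (m ℕ.<? suc t) ≡ does (m ℕ.<? t)
<?-suc {m} {t} m≢t with m ℕ.<? t
... | yes m<t = trans (dec-true (m ℕ.<? suc t) (ℕ.m<n⇒m<1+n m<t)) (sym (dec-true (m ℕ.<? t) m<t))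
... | no  m≮t = trans (dec-false (m ℕ.<? suc t) (λ m<1+t → m≮t (ℕ.≤∧≢⇒< (ℕ.s≤s⁻¹ m<1+t) m≢t)))
                      (sym (dec-false (m ℕ.<? t) m≮t))

-- The rows of S ∙ M are put in place one at a time, in the order given by π; by triangularity each
-- step is a row operation that multiplies the determinant by a diagonal entry of S.
module _ (π : Permutation′ n) (S M : Matrix n)
         (S-triangular : ∀ i k → π ⟨$⟩ʳ k Fin.< π ⟨$⟩ʳ i → S i k ≡ 0ℤ) where

  private
    rank : Fin n → ℕ
    rank i = toℕ (π ⟨$⟩ʳ i)

    rank-injective : ∀ {i j} → rank i ≡ rank j → i ≡ j
    rank-injective {i} {j} eq =
      trans (sym (Perm.inverseˡ π)) (trans (cong (π ⟨$⟩ˡ_) (Fin.toℕ-injective eq)) (Perm.inverseˡ π))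

    halfway : ℕ → Matrix n
    halfway t i = if does (rank i ℕ.<? t) then (S ∙ M) i else M i

    halfwayDiagonal : ℕ → Fin n → ℤ
    halfwayDiagonal t i = if does (rank i ℕ.<? t) then S i i else 1ℤ

    module Step {t : ℕ} (t<n : t ℕ.< n) where
      r : Fin n
      r = π ⟨$⟩ˡ Fin.fromℕ< t<n

      rank-r : rank r ≡ t
      rank-r = trans (cong toℕ (Perm.inverseʳ π)) (Fin.toℕ-fromℕ< t<n)

      rank-other : ∀ {i} → i ≢ r → rank i ≢ t
      rank-other i≢r eq = i≢r (rank-injective (trans eq (sym rank-r)))

      halfway-step : halfway (suc t) ≋ halfway t [ r ]≔ (λ j → ∑[ k < n ] (S r k * halfway t k j))
      halfway-step i j with i Fin.≟ r
      ... | no  i≢r  = trans (cong-app (cong (λ b → if b then (S ∙ M) i else M i) (<?-suc (rank-other i≢r))) j)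
                             (sym (cong-app (updateAt-minimal i r (halfway t) i≢r) j))
      ... | yes refl = begin
        halfway (suc t) r j
          ≡⟨ cong (λ b → (if b then (S ∙ M) r else M r) j)
                  (dec-true (rank r ℕ.<? suc t) (ℕ.≤-reflexive (cong suc rank-r))) ⟩
        ∑[ k < n ] (S r k * M k j)
          ≡⟨ sum-cong-≗ unchanged ⟩
        ∑[ k < n ] (S r k * halfway t k j)
          ≡⟨ cong-app (updateAt-updates r (halfway t)) j ⟨
        (halfway t [ r ]≔ (λ j → ∑[ k < n ] (S r k * halfway t k j))) r j ∎
        where
        unchanged : ∀ k → S r k * M k j ≡ S r k * halfway t k j
        unchanged k with rank k ℕ.<? t
        ... | yes rank-k<t = trans (cong (_* M k j) S-rk≡0) (sym (cong (_* halfway t k j) S-rk≡0))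
          where
          S-rk≡0 : S r k ≡ 0ℤ
          S-rk≡0 = S-triangular r k (subst (rank k ℕ.<_) (sym rank-r) rank-k<t)
        ... | no  rank-k≮t = cong (λ row → S r k * row j)
                                  (sym (cong (λ b → if b then (S ∙ M) k else M k) (dec-false (rank k ℕ.<? t) rank-k≮t)))

      halfwayDiagonal-step : ∀ i → halfwayDiagonal (suc t) i ≡ updateAt (halfwayDiagonal t) r (const (S r r)) i
      halfwayDiagonal-step i with i Fin.≟ r
      ... | no  i≢r  = trans (cong (λ b → if b then S i i else 1ℤ) (<?-suc (rank-other i≢r)))
                             (sym (updateAt-minimal i r (halfwayDiagonal t) i≢r))
      ... | yes refl = trans (cong (λ b → if b then S r r else 1ℤ)
                                   (dec-true (rank r ℕ.<? suc t) (ℕ.≤-reflexive (cong suc rank-r))))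
                             (sym (updateAt-updates r (halfwayDiagonal t)))

      ∏-step : ∏ (halfwayDiagonal (suc t)) ≡ S r r * ∏ (halfwayDiagonal t)
      ∏-step = begin
        ∏ (halfwayDiagonal (suc t))
          ≡⟨ ℤ.*-identityʳ _ ⟨
        ∏ (halfwayDiagonal (suc t)) * 1ℤ
          ≡⟨ cong₂ _*_ (∏-cong halfwayDiagonal-step) (sym r-not-yet-multiplied) ⟩
        ∏ (updateAt (halfwayDiagonal t) r (const (S r r))) * halfwayDiagonal t r
          ≡⟨ ∏-updateAt (halfwayDiagonal t) r (S r r) ⟩
        S r r * ∏ (halfwayDiagonal t)
          ∎
        where
        r-not-yet-multiplied : halfwayDiagonal t r ≡ 1ℤ
        r-not-yet-multiplied = cong (λ b → if b then S r r else 1ℤ) (dec-false (rank r ℕ.<? t) (ℕ.<-irrefl rank-r))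

    det-halfway : ∀ t → t ℕ.≤ n → det (halfway t) ≡ ∏ (halfwayDiagonal t) * det M
    det-halfway zero _ = begin
      det (halfway zero)
        ≡⟨ det-cong-rows (λ i → cong (λ b → if b then (S ∙ M) i else M i) (none-below i)) ⟩
      det M
        ≡⟨ ℤ.*-identityˡ (det M) ⟨
      1ℤ * det M
        ≡⟨ cong (_* det M) ∏-none-below ⟨
      ∏ (halfwayDiagonal zero) * det M ∎
      where
      none-below : ∀ i → does (rank i ℕ.<? 0) ≡ false
      none-below i = dec-false (rank i ℕ.<? 0) λ ()
      ∏-none-below : ∏ (halfwayDiagonal zero) ≡ 1ℤ
      ∏-none-below = trans (∏-cong (λ i → cong (λ b → if b then S i i else 1ℤ) (none-below i)))
                           (trans (∏-const n 1ℤ) (ℤ.^-zeroˡ n))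
    det-halfway (suc t) t<n = begin
      det (halfway (suc t))
        ≡⟨ det-cong halfway-step ⟩
      det (halfway t [ r ]≔ (λ j → ∑[ k < n ] (S r k * halfway t k j)))
        ≡⟨ det-row-combination (halfway t) r (S r) ⟩
      S r r * det (halfway t)
        ≡⟨ cong (S r r *_) (det-halfway t (ℕ.<⇒≤ t<n)) ⟩
      S r r * (∏ (halfwayDiagonal t) * det M)
        ≡⟨ ℤ.*-assoc (S r r) (∏ (halfwayDiagonal t)) (det M) ⟨
      S r r * ∏ (halfwayDiagonal t) * det M
        ≡⟨ cong (_* det M) ∏-step ⟨
      ∏ (halfwayDiagonal (suc t)) * det M ∎
      where open Step t<n

  det-∙-triangular : det (S ∙ M) ≡ ∏ (λ i → S i i) * det M
  det-∙-triangular = begin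
    det (S ∙ M)
      ≡⟨ det-cong-rows (λ i → cong (λ b → if b then (S ∙ M) i else M i) (all-below i)) ⟨
    det (halfway n)
      ≡⟨ det-halfway n ℕ.≤-refl ⟩
    ∏ (halfwayDiagonal n) * det M
      ≡⟨ cong (_* det M) (∏-cong (λ i → cong (λ b → if b then S i i else 1ℤ) (all-below i))) ⟩
    ∏ (λ i → S i i) * det M ∎
    where
    all-below : ∀ i → does (rank i ℕ.<? n) ≡ true
    all-below i = dec-true (rank i ℕ.<? n) (Fin.toℕ<n (π ⟨$⟩ʳ i))

opposite-cancel-< : {i k : Fin n} → Fin.opposite k Fin.< Fin.opposite i → i Fin.< k
opposite-cancel-< {n} {i} {k} lt = ℕ.≰⇒> λ k≤i →
  ℕ.<⇒≱ (subst₂ ℕ._<_ (Fin.opposite-prop k) (Fin.opposite-prop i) lt) (ℕ.∸-monoʳ-≤ n (ℕ.s≤s k≤i))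

det-∙-upper : (S M : Matrix n) → UpperTriangular S → det (S ∙ M) ≡ ∏ (λ i → S i i) * det M
det-∙-upper S M S-upper = det-∙-triangular Perm.id S M S-upper

det-∙-lower : (S M : Matrix n) → LowerTriangular S → det (S ∙ M) ≡ ∏ (λ i → S i i) * det M
det-∙-lower S M S-lower = det-∙-triangular Perm.reverse S M (λ i k lt → S-lower i k (opposite-cancel-< lt))

-- Block matrices

blocks : (Fin m → Fin m → ℤ) → (Fin m → Fin n → ℤ) → (Fin n → Fin m → ℤ) → (Fin n → Fin n → ℤ) →
         Matrix (m ℕ.+ n)
blocks {m} A B C D i j with splitAt m i | splitAt m j
... | inj₁ i′ | inj₁ j′ = A i′ j′
... | inj₁ i′ | inj₂ j′ = B i′ j′
... | inj₂ i′ | inj₁ j′ = C i′ j′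
... | inj₂ i′ | inj₂ j′ = D i′ j′

module _ (A : Fin m → Fin m → ℤ) (B : Fin m → Fin n → ℤ) (C : Fin n → Fin m → ℤ) (D : Fin n → Fin n → ℤ) where

  blocks-↑ˡ↑ˡ : ∀ i j → blocks A B C D (i ↑ˡ n) (j ↑ˡ n) ≡ A i j
  blocks-↑ˡ↑ˡ i j rewrite Fin.splitAt-↑ˡ m i n | Fin.splitAt-↑ˡ m j n = refl

  blocks-↑ˡ↑ʳ : ∀ i j → blocks A B C D (i ↑ˡ n) (m ↑ʳ j) ≡ B i j
  blocks-↑ˡ↑ʳ i j rewrite Fin.splitAt-↑ˡ m i n | Fin.splitAt-↑ʳ m n j = refl

  blocks-↑ʳ↑ˡ : ∀ i j → blocks A B C D (m ↑ʳ i) (j ↑ˡ n) ≡ C i j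
  blocks-↑ʳ↑ˡ i j rewrite Fin.splitAt-↑ʳ m n i | Fin.splitAt-↑ˡ m j n = refl

  blocks-↑ʳ↑ʳ : ∀ i j → blocks A B C D (m ↑ʳ i) (m ↑ʳ j) ≡ D i j
  blocks-↑ʳ↑ʳ i j rewrite Fin.splitAt-↑ʳ m n i | Fin.splitAt-↑ʳ m n j = refl

↑-elim : (P : Fin (m ℕ.+ n) → Set) → (∀ i → P (i ↑ˡ n)) → (∀ j → P (m ↑ʳ j)) → ∀ k → P k
↑-elim {m} {n} P left right k = subst P (Fin.join-splitAt m n k) (elim (splitAt m k))
  where
  elim : ∀ s → P (Fin.join m n s)
  elim (inj₁ i) = left i
  elim (inj₂ j) = right j

blockwise : (P : Fin (m ℕ.+ n) → Fin (m ℕ.+ n) → Set) →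
            (∀ i j → P (i ↑ˡ n) (j ↑ˡ n)) → (∀ i j → P (i ↑ˡ n) (m ↑ʳ j)) →
            (∀ i j → P (m ↑ʳ i) (j ↑ˡ n)) → (∀ i j → P (m ↑ʳ i) (m ↑ʳ j)) → ∀ k l → P k l
blockwise P ll lr rl rr k l =
  ↑-elim (λ k → P k l) (λ i → ↑-elim (P (i ↑ˡ _)) (ll i) (lr i) l) (λ i → ↑-elim (P (_ ↑ʳ i)) (rl i) (rr i) l) k

↑ˡ<↑ʳ : (i : Fin m) (j : Fin n) → i ↑ˡ n Fin.< m ↑ʳ j
↑ˡ<↑ʳ {m} {n} i j = subst₂ ℕ._<_ (sym (Fin.toℕ-↑ˡ i n)) (sym (Fin.toℕ-↑ʳ m j))
                                 (ℕ.<-≤-trans (Fin.toℕ<n i) (ℕ.m≤m+n m (toℕ j)))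

↑ˡ-cancel-< : {i j : Fin m} → i ↑ˡ n Fin.< j ↑ˡ n → i Fin.< j
↑ˡ-cancel-< {n = n} {i} {j} = subst₂ ℕ._<_ (Fin.toℕ-↑ˡ i n) (Fin.toℕ-↑ˡ j n)

↑ʳ-cancel-< : {i j : Fin n} → m ↑ʳ i Fin.< m ↑ʳ j → i Fin.< j
↑ʳ-cancel-< {m = m} {i} {j} lt = ℕ.+-cancelˡ-< m _ _ (subst₂ ℕ._<_ (Fin.toℕ-↑ʳ m i) (Fin.toℕ-↑ʳ m j) lt)

blocks-upper : (A : Matrix m) (B : Fin m → Fin n → ℤ) (D : Matrix n) →
               UpperTriangular A → UpperTriangular D → UpperTriangular (blocks A B O D)
blocks-upper {m} {n} A B D A-upper D-upper = blockwise (λ k l → l Fin.< k → blocks A B O D k l ≡ 0ℤ)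
  (λ i j j<i → trans (blocks-↑ˡ↑ˡ A B O D i j) (A-upper i j (↑ˡ-cancel-< j<i)))
  (λ i j m+j<i → contradiction (↑ˡ<↑ʳ i j) (ℕ.<-asym m+j<i))
  (λ i j _ → blocks-↑ʳ↑ˡ A B O D i j)
  (λ i j j<i → trans (blocks-↑ʳ↑ʳ A B O D i j) (D-upper i j (↑ʳ-cancel-< j<i)))

blocks-∙ : (A A′ : Matrix m) (B B′ : Fin m → Fin n → ℤ) (C C′ : Fin n → Fin m → ℤ) (D D′ : Matrix n) →
           blocks A B C D ∙ blocks A′ B′ C′ D′
             ≋ blocks (A ∙ A′ ⊞ B ∙ C′) (A ∙ B′ ⊞ B ∙ D′) (C ∙ A′ ⊞ D ∙ C′) (C ∙ B′ ⊞ D ∙ D′)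
blocks-∙ {m} {n} A A′ B B′ C C′ D D′ = blockwise (λ k l → (X ∙ Y) k l ≡ Z k l)
  (λ i j → product (blocks-↑ˡ↑ˡ A B C D i) (blocks-↑ˡ↑ʳ A B C D i)
                   (λ k → blocks-↑ˡ↑ˡ A′ B′ C′ D′ k j) (λ k → blocks-↑ʳ↑ˡ A′ B′ C′ D′ k j) (blocks-↑ˡ↑ˡ Z₁ Z₂ Z₃ Z₄ i j))
  (λ i j → product (blocks-↑ˡ↑ˡ A B C D i) (blocks-↑ˡ↑ʳ A B C D i)
                   (λ k → blocks-↑ˡ↑ʳ A′ B′ C′ D′ k j) (λ k → blocks-↑ʳ↑ʳ A′ B′ C′ D′ k j) (blocks-↑ˡ↑ʳ Z₁ Z₂ Z₃ Z₄ i j))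
  (λ i j → product (blocks-↑ʳ↑ˡ A B C D i) (blocks-↑ʳ↑ʳ A B C D i)
                   (λ k → blocks-↑ˡ↑ˡ A′ B′ C′ D′ k j) (λ k → blocks-↑ʳ↑ˡ A′ B′ C′ D′ k j) (blocks-↑ʳ↑ˡ Z₁ Z₂ Z₃ Z₄ i j))
  (λ i j → product (blocks-↑ʳ↑ˡ A B C D i) (blocks-↑ʳ↑ʳ A B C D i)
                   (λ k → blocks-↑ˡ↑ʳ A′ B′ C′ D′ k j) (λ k → blocks-↑ʳ↑ʳ A′ B′ C′ D′ k j) (blocks-↑ʳ↑ʳ Z₁ Z₂ Z₃ Z₄ i j))
  where
  X Y Z : Matrix (m ℕ.+ n)
  X = blocks A B C D
  Y = blocks A′ B′ C′ D′
  Z₁ = A ∙ A′ ⊞ B ∙ C′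
  Z₂ = A ∙ B′ ⊞ B ∙ D′
  Z₃ = C ∙ A′ ⊞ D ∙ C′
  Z₄ = C ∙ B′ ⊞ D ∙ D′
  Z = blocks Z₁ Z₂ Z₃ Z₄
  product : ∀ {k l} {x₁ y₁ : Fin m → ℤ} {x₂ y₂ : Fin n → ℤ} →
            (∀ i → X k (i ↑ˡ n) ≡ x₁ i) → (∀ j → X k (m ↑ʳ j) ≡ x₂ j) →
            (∀ i → Y (i ↑ˡ n) l ≡ y₁ i) → (∀ j → Y (m ↑ʳ j) l ≡ y₂ j) →
            Z k l ≡ sum (λ i → x₁ i * y₁ i) + sum (λ j → x₂ j * y₂ j) → (X ∙ Y) k l ≡ Z k l
  product {k} {l} x₁≡ x₂≡ y₁≡ y₂≡ Z≡ = begin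
    (X ∙ Y) k l
      ≡⟨ fold-↑ ℤ.+-0-monoid m (λ k′ → X k k′ * Y k′ l) ⟩
    sum (λ i → X k (i ↑ˡ n) * Y (i ↑ˡ n) l) + sum (λ j → X k (m ↑ʳ j) * Y (m ↑ʳ j) l)
      ≡⟨ cong₂ _+_ (sum-cong-≗ (λ i → cong₂ _*_ (x₁≡ i) (y₁≡ i))) (sum-cong-≗ (λ j → cong₂ _*_ (x₂≡ j) (y₂≡ j))) ⟩
    _
      ≡⟨ Z≡ ⟨
    Z k l ∎

blocks-cong : {A A′ : Matrix m} {B B′ : Fin m → Fin n → ℤ} {C C′ : Fin n → Fin m → ℤ} {D D′ : Matrix n} →
              A ≋ A′ → B ≋ B′ → C ≋ C′ → D ≋ D′ → blocks A B C D ≋ blocks A′ B′ C′ D′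
blocks-cong {A = A} {A′} {B} {B′} {C} {C′} {D} {D′} A≋ B≋ C≋ D≋ =
  blockwise (λ k l → blocks A B C D k l ≡ blocks A′ B′ C′ D′ k l)
    (λ i j → trans (blocks-↑ˡ↑ˡ A B C D i j) (trans (A≋ i j) (sym (blocks-↑ˡ↑ˡ A′ B′ C′ D′ i j))))
    (λ i j → trans (blocks-↑ˡ↑ʳ A B C D i j) (trans (B≋ i j) (sym (blocks-↑ˡ↑ʳ A′ B′ C′ D′ i j))))
    (λ i j → trans (blocks-↑ʳ↑ˡ A B C D i j) (trans (C≋ i j) (sym (blocks-↑ʳ↑ˡ A′ B′ C′ D′ i j))))
    (λ i j → trans (blocks-↑ʳ↑ʳ A B C D i j) (trans (D≋ i j) (sym (blocks-↑ʳ↑ʳ A′ B′ C′ D′ i j))))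

punchIn-↑ˡ : ∀ {m} n (j : Fin (suc m)) (s : Fin m) → punchIn (j ↑ˡ n) (s ↑ˡ n) ≡ punchIn j s ↑ˡ n
punchIn-↑ˡ n zero    s       = refl
punchIn-↑ˡ n (suc j) zero    = refl
punchIn-↑ˡ n (suc j) (suc s) = cong suc (punchIn-↑ˡ n j s)

punchIn-↑ʳ : ∀ {m} n (j : Fin (suc m)) (s : Fin n) → punchIn (j ↑ˡ n) (m ↑ʳ s) ≡ suc m ↑ʳ s
punchIn-↑ʳ         n zero     s = refl
punchIn-↑ʳ {zero}  n (suc ()) s
punchIn-↑ʳ {suc m} n (suc j)  s = cong suc (punchIn-↑ʳ n j s)

minor-blocks : (A : Matrix (suc m)) (B : Fin (suc m) → Fin n → ℤ) (C : Fin n → Fin (suc m) → ℤ) (D : Matrix n)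
               (j : Fin (suc m)) →
               minor (blocks A B C D) (j ↑ˡ n) ≋ blocks (minor A j) (λ r s → B (suc r) s) (λ r s → C r (punchIn j s)) D
minor-blocks {m} {n} A B C D j = blockwise (λ r s → minor X (j ↑ˡ n) r s ≡ blocks A′ B′ C′ D r s)
  (λ r s → trans (cong (X (suc r ↑ˡ n)) (punchIn-↑ˡ n j s))
                 (trans (blocks-↑ˡ↑ˡ A B C D (suc r) (punchIn j s)) (sym (blocks-↑ˡ↑ˡ A′ B′ C′ D r s))))
  (λ r s → trans (cong (X (suc r ↑ˡ n)) (punchIn-↑ʳ n j s))
                 (trans (blocks-↑ˡ↑ʳ A B C D (suc r) s) (sym (blocks-↑ˡ↑ʳ A′ B′ C′ D r s))))
  (λ r s → trans (cong (X (suc m ↑ʳ r)) (punchIn-↑ˡ n j s))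
                 (trans (blocks-↑ʳ↑ˡ A B C D r (punchIn j s)) (sym (blocks-↑ʳ↑ˡ A′ B′ C′ D r s))))
  (λ r s → trans (cong (X (suc m ↑ʳ r)) (punchIn-↑ʳ n j s))
                 (trans (blocks-↑ʳ↑ʳ A B C D r s) (sym (blocks-↑ʳ↑ʳ A′ B′ C′ D r s))))
  where
  X : Matrix (suc m ℕ.+ n)
  X = blocks A B C D
  A′ : Matrix m
  A′ = minor A j
  B′ : Fin m → Fin n → ℤ
  B′ r s = B (suc r) s
  C′ : Fin n → Fin m → ℤ
  C′ r s = C r (punchIn j s)

det-blocks-lower : (A : Matrix m) (C : Fin n → Fin m → ℤ) (D : Matrix n) → det (blocks A O C D) ≡ det A * det D
det-blocks-lower {zero}      A C D = sym (ℤ.*-identityˡ (det D))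
det-blocks-lower {suc m} {n} A C D = begin
  det X
    ≡⟨ det-expand X ⟩
  sum (λ k → sign (toℕ k) * X zero k * det (minor X k))
    ≡⟨ fold-↑ ℤ.+-0-monoid (suc m) (λ k → sign (toℕ k) * X zero k * det (minor X k)) ⟩
  sum (λ j → sign (toℕ (j ↑ˡ n)) * X zero (j ↑ˡ n) * det (minor X (j ↑ˡ n)))
    + sum (λ j → sign (toℕ (suc m ↑ʳ j)) * X zero (suc m ↑ʳ j) * det (minor X (suc m ↑ʳ j)))
    ≡⟨ cong₂ _+_ (sum-cong-≗ left-column) (sum-zero right-column) ⟩
  sum (λ j → sign (toℕ j) * A zero j * det (minor A j) * det D) + 0ℤ
    ≡⟨ ℤ.+-identityʳ _ ⟩
  sum (λ j → sign (toℕ j) * A zero j * det (minor A j) * det D)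
    ≡⟨ *-distribʳ-sum (det D) (λ j → sign (toℕ j) * A zero j * det (minor A j)) ⟨
  sum (λ j → sign (toℕ j) * A zero j * det (minor A j)) * det D
    ≡⟨ cong (_* det D) (det-expand A) ⟨
  det A * det D
    ∎
  where
  X : Matrix (suc m ℕ.+ n)
  X = blocks A O C D
  left-column : ∀ j → sign (toℕ (j ↑ˡ n)) * X zero (j ↑ˡ n) * det (minor X (j ↑ˡ n))
                    ≡ sign (toℕ j) * A zero j * det (minor A j) * det D
  left-column j = begin
    sign (toℕ (j ↑ˡ n)) * X zero (j ↑ˡ n) * det (minor X (j ↑ˡ n))
      ≡⟨ cong₂ (λ a b → sign a * b * det (minor X (j ↑ˡ n))) (Fin.toℕ-↑ˡ j n) (blocks-↑ˡ↑ˡ A O C D zero j) ⟩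
    sign (toℕ j) * A zero j * det (minor X (j ↑ˡ n))
      ≡⟨ cong (sign (toℕ j) * A zero j *_) (trans (det-cong (minor-blocks A O C D j))
                                                  (det-blocks-lower (minor A j) (λ r s → C r (punchIn j s)) D)) ⟩
    sign (toℕ j) * A zero j * (det (minor A j) * det D)
      ≡⟨ ℤ.*-assoc (sign (toℕ j) * A zero j) (det (minor A j)) (det D) ⟨
    sign (toℕ j) * A zero j * det (minor A j) * det D
      ∎
  right-column : ∀ j → sign (toℕ (suc m ↑ʳ j)) * X zero (suc m ↑ʳ j) * det (minor X (suc m ↑ʳ j)) ≡ 0ℤ
  right-column j = begin
    sign (toℕ (suc m ↑ʳ j)) * X zero (suc m ↑ʳ j) * det (minor X (suc m ↑ʳ j))
      ≡⟨ cong (λ b → sign (toℕ (suc m ↑ʳ j)) * b * det (minor X (suc m ↑ʳ j))) (blocks-↑ˡ↑ʳ A O C D zero j) ⟩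
    sign (toℕ (suc m ↑ʳ j)) * 0ℤ * det (minor X (suc m ↑ʳ j))
      ≡⟨ cong (_* det (minor X (suc m ↑ʳ j))) (ℤ.*-zeroʳ (sign (toℕ (suc m ↑ʳ j)))) ⟩
    0ℤ
      ∎

charMat-bipartite : (x : ℤ) (P : Fin m → Fin n → ℤ) (Q : Fin n → Fin m → ℤ) →
                    charMat x (blocks O P Q O) ≋ blocks (scalar x) (λ i j → - P i j) (λ i j → - Q i j) (scalar x)
charMat-bipartite {m} {n} x P Q = blockwise (λ k l → charMat x X k l ≡ Y k l)
  (λ i j → entry (δ-injective (λ {a} {b} → Fin.↑ˡ-injective n a b) i j) (blocks-↑ˡ↑ˡ O P Q O i j)
                 (trans (blocks-↑ˡ↑ˡ Y₁ Y₂ Y₃ Y₄ i j) (sym (ℤ.+-identityʳ _))))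
  (λ i j → entry (δ-≢ (Fin.<⇒≢ (↑ˡ<↑ʳ i j))) (blocks-↑ˡ↑ʳ O P Q O i j)
                 (trans (blocks-↑ˡ↑ʳ Y₁ Y₂ Y₃ Y₄ i j) (minus (P i j))))
  (λ i j → entry (δ-≢ (Fin.<⇒≢ (↑ˡ<↑ʳ j i) ∘ sym)) (blocks-↑ʳ↑ˡ O P Q O i j)
                 (trans (blocks-↑ʳ↑ˡ Y₁ Y₂ Y₃ Y₄ i j) (minus (Q i j))))
  (λ i j → entry (δ-injective (λ {a} {b} → Fin.↑ʳ-injective m a b) i j) (blocks-↑ʳ↑ʳ O P Q O i j)
                 (trans (blocks-↑ʳ↑ʳ Y₁ Y₂ Y₃ Y₄ i j) (sym (ℤ.+-identityʳ _))))
  where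
  X Y : Matrix (m ℕ.+ n)
  X = blocks O P Q O
  Y₁ : Matrix m
  Y₁ = scalar x
  Y₂ : Fin m → Fin n → ℤ
  Y₂ i j = - P i j
  Y₃ : Fin n → Fin m → ℤ
  Y₃ i j = - Q i j
  Y₄ : Matrix n
  Y₄ = scalar x
  Y = blocks Y₁ Y₂ Y₃ Y₄
  entry : ∀ {k l d b} → δ k l ≡ d → X k l ≡ b → Y k l ≡ x * d - b → charMat x X k l ≡ Y k l
  entry {k} {l} δ≡ X≡ Y≡ = trans (charMat-≡ x X k l) (trans (cong₂ (λ d b → x * d - b) δ≡ X≡) (sym Y≡))
  minus : ∀ b → - b ≡ x * 0ℤ - b
  minus b = sym (trans (cong (_- b) (ℤ.*-zeroʳ x)) (ℤ.+-identityˡ (- b)))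

-- Multiplying by the upper triangular [[x I, P], [0, I]] clears the top right block.
det-charMat-bipartite : (x : ℤ) (P : Fin m → Fin n → ℤ) (Q : Fin n → Fin m → ℤ) →
                        x ^ m * det (charMat x (blocks O P Q O)) ≡ x ^ n * det (charMat (x * x) (P ∙ Q))
det-charMat-bipartite {m} {n} x P Q = begin
  x ^ m * det (charMat x (blocks O P Q O))
    ≡⟨ cong₂ _*_ (sym ∏-diagonal-S) (det-cong (charMat-bipartite x P Q)) ⟩
  ∏ (λ k → S k k) * det N
    ≡⟨ det-∙-upper S N S-upper ⟨
  det (S ∙ N)
    ≡⟨ det-cong S∙N ⟩
  det (blocks (charMat (x * x) (P ∙ Q)) O -Q (scalar x))
    ≡⟨ det-blocks-lower (charMat (x * x) (P ∙ Q)) -Q (scalar x) ⟩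
  det (charMat (x * x) (P ∙ Q)) * det (scalar {n} x)
    ≡⟨ cong (det (charMat (x * x) (P ∙ Q)) *_) (det-scalar {n} x) ⟩
  det (charMat (x * x) (P ∙ Q)) * x ^ n
    ≡⟨ ℤ.*-comm _ (x ^ n) ⟩
  x ^ n * det (charMat (x * x) (P ∙ Q)) ∎
  where
  -P : Fin m → Fin n → ℤ
  -P i j = - P i j
  -Q : Fin n → Fin m → ℤ
  -Q i j = - Q i j
  S N : Matrix (m ℕ.+ n)
  S = blocks (scalar x) P O (scalar 1ℤ)
  N = blocks (scalar x) -P -Q (scalar x)

  S-upper : UpperTriangular S
  S-upper = blocks-upper (scalar x) P (scalar 1ℤ) (diag-upper (const x)) (diag-upper (const 1ℤ))

  ∏-diagonal-S : ∏ (λ k → S k k) ≡ x ^ m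
  ∏-diagonal-S = begin
    ∏ (λ k → S k k)
      ≡⟨ fold-↑ ℤ.*-1-monoid m (λ k → S k k) ⟩
    ∏ (λ i → S (i ↑ˡ n) (i ↑ˡ n)) * ∏ (λ j → S (m ↑ʳ j) (m ↑ʳ j))
      ≡⟨ cong₂ _*_ (∏-cong (λ i → blocks-↑ˡ↑ˡ (scalar x) P O (scalar 1ℤ) i i))
                   (∏-cong (λ j → blocks-↑ʳ↑ʳ (scalar x) P O (scalar 1ℤ) j j)) ⟩
    ∏ (λ i → scalar {m} x i i) * ∏ (λ j → scalar {n} 1ℤ j j)
      ≡⟨ cong₂ _*_ (trans (∏-diag {m} (const x)) (∏-const m x))
                   (trans (∏-diag {n} (const 1ℤ)) (trans (∏-const n 1ℤ) (ℤ.^-zeroˡ n))) ⟩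
    x ^ m * 1ℤ
      ≡⟨ ℤ.*-identityʳ _ ⟩
    x ^ m ∎

  S∙N : S ∙ N ≋ blocks (charMat (x * x) (P ∙ Q)) O -Q (scalar x)
  S∙N k l = trans (blocks-∙ (scalar x) (scalar x) P -P O -Q (scalar 1ℤ) (scalar x) k l)
                  (blocks-cong top-left top-right bottom-left bottom-right k l)
    where
    top-left : scalar x ∙ scalar x ⊞ P ∙ -Q ≋ charMat (x * x) (P ∙ Q)
    top-left i j = begin
      (scalar x ∙ scalar x) i j + (P ∙ -Q) i j
        ≡⟨ cong₂ _+_ (diag-∙ (const x) (scalar x) i j) (∙-neg P Q i j) ⟩
      x * (x * δ i j) + - (P ∙ Q) i j
        ≡⟨ cong (_- (P ∙ Q) i j) (ℤ.*-assoc x x (δ i j)) ⟨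
      x * x * δ i j - (P ∙ Q) i j
        ≡⟨ charMat-≡ (x * x) (P ∙ Q) i j ⟨
      charMat (x * x) (P ∙ Q) i j ∎
    top-right : scalar x ∙ -P ⊞ P ∙ scalar x ≋ O
    top-right i j = trans (cong₂ _+_ (diag-∙ (const x) -P i j) (∙-diag (const x) P i j)) (cancel x (P i j))
      where
      cancel : ∀ x p → x * - p + p * x ≡ 0ℤ
      cancel = solve-∀
    bottom-left : O ∙ scalar x ⊞ scalar 1ℤ ∙ -Q ≋ -Q
    bottom-left i j = trans (cong₂ _+_ (O-∙ (scalar x) i j) (diag-∙ (const 1ℤ) -Q i j))
                            (trans (ℤ.+-identityˡ _) (ℤ.*-identityˡ (- Q i j)))
    bottom-right : O ∙ -P ⊞ scalar 1ℤ ∙ scalar x ≋ scalar x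
    bottom-right i j = trans (cong₂ _+_ (O-∙ -P i j) (diag-∙ (const 1ℤ) (scalar x) i j))
                             (trans (ℤ.+-identityˡ _) (ℤ.*-identityˡ (scalar x i j)))

-- Left eigenvectors

record Eigenrows (F X : Matrix n) (μ : Fin n → ℤ) : Set where
  constructor eigenrows
  field eigen : F ∙ X ≋ λ i j → μ i * F i j

Eigenrows-cong : {F F′ X : Matrix n} {μ : Fin n → ℤ} → F ≋ F′ → Eigenrows F X μ → Eigenrows F′ X μ
Eigenrows-cong {F = F} {F′} {X} {μ} F≋F′ (eigenrows eigen) = eigenrows λ i j → begin
  (F′ ∙ X) i j   ≡⟨ sum-cong-≗ (λ k → cong (_* X k j) (F≋F′ i k)) ⟨
  (F ∙ X) i j    ≡⟨ eigen i j ⟩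
  μ i * F i j    ≡⟨ cong (μ i *_) (F≋F′ i j) ⟩
  μ i * F′ i j   ∎

Eigenrows-charMat : {F X : Matrix n} {μ : Fin n → ℤ} (y : ℤ) → Eigenrows F X μ → Eigenrows F (charMat y X) (λ i → y - μ i)
Eigenrows-charMat {n} {F} {X} {μ} y (eigenrows eigen) = eigenrows λ i j → begin
  ∑[ k < n ] (F i k * charMat y X k j)
    ≡⟨ sum-cong-≗ (λ k → trans (cong (F i k *_) (charMat-≡ y X k j)) (expand (F i k) y (δ k j) (X k j))) ⟩
  ∑[ k < n ] (F i k * y * δ k j + - (F i k * X k j))
    ≡⟨ ∑-distrib-+ (λ k → F i k * y * δ k j) (λ k → - (F i k * X k j)) ⟩
  ∑[ k < n ] (F i k * y * δ k j) + ∑[ k < n ] (- (F i k * X k j))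
    ≡⟨ cong₂ _+_ (sum-δʳ j (λ k → F i k * y)) (sum-neg (λ k → F i k * X k j)) ⟩
  F i j * y - (F ∙ X) i j
    ≡⟨ cong (λ z → F i j * y - z) (eigen i j) ⟩
  F i j * y - μ i * F i j
    ≡⟨ factor (F i j) y (μ i) ⟩
  (y - μ i) * F i j ∎
  where
  expand : ∀ f y d x → f * (y * d - x) ≡ f * y * d + - (f * x)
  expand = solve-∀
  factor : ∀ f y m → f * y - m * f ≡ (y - m) * f
  factor = solve-∀

det-eigenrows : (U L X : Matrix n) (μ : Fin n → ℤ) →
                UpperTriangular U → (∀ i → U i i ≢ 0ℤ) → LowerTriangular L → (∀ i → L i i ≡ 1ℤ) →
                Eigenrows (U ∙ L) X μ → det X ≡ ∏ μ
det-eigenrows {n} U L X μ U-upper U≢0 L-lower L≡1 (eigenrows eigen) =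
  ℤ.*-cancelˡ-≡ ∏U (det X) (∏ μ) {{ℤ.≢-nonZero (∏-≢0 (λ i → U i i) U≢0)}} (begin
    ∏U * det X
      ≡⟨ cong (∏U *_) (trans (sym (ℤ.*-identityˡ (det X))) (cong (_* det X) (sym ∏L≡1))) ⟩
    ∏U * (∏L * det X)
      ≡⟨ cong (∏U *_) (det-∙-lower L X L-lower) ⟨
    ∏U * det (L ∙ X)
      ≡⟨ det-∙-upper U (L ∙ X) U-upper ⟨
    det (U ∙ (L ∙ X))
      ≡⟨ det-cong (∙-assoc U L X) ⟩
    det ((U ∙ L) ∙ X)
      ≡⟨ det-cong (λ i j → trans (eigen i j) (sym (diag-∙ μ (U ∙ L) i j))) ⟩
    det (diag μ ∙ (U ∙ L))
      ≡⟨ det-∙-upper (diag μ) (U ∙ L) (diag-upper μ) ⟩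
    ∏ (λ i → diag μ i i) * det (U ∙ L)
      ≡⟨ cong₂ _*_ (∏-diag μ) (det-∙-upper U L U-upper) ⟩
    ∏ μ * (∏U * det L)
      ≡⟨ cong (λ z → ∏ μ * (∏U * z)) (trans (det-lower L L-lower) ∏L≡1) ⟩
    ∏ μ * (∏U * 1ℤ)
      ≡⟨ trans (cong (∏ μ *_) (ℤ.*-identityʳ ∏U)) (ℤ.*-comm (∏ μ) ∏U) ⟩
    ∏U * ∏ μ                    ∎)
  where
  ∏U ∏L : ℤ
  ∏U = ∏ (λ i → U i i)
  ∏L = ∏ (λ i → L i i)
  ∏L≡1 : ∏L ≡ 1ℤ
  ∏L≡1 = trans (∏-cong L≡1) (trans (∏-const n 1ℤ) (ℤ.^-zeroˡ n))

-- Kronecker products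

infixl 7 _⊗_
_⊗_ : ∀ {d c} → Matrix d → Matrix c → Matrix (d ℕ.* c)
(_⊗_ {d} {c} X Y) e e′ = X (quotient c e) (quotient c e′) * Y (remainder {d} c e) (remainder {d} c e′)

quotient-combine : ∀ {d c} (a : Fin d) (b : Fin c) → quotient c (combine a b) ≡ a
quotient-combine {d} {c} a b = cong proj₁ (Fin.remQuot-combine {d} {c} a b)

remainder-combine : ∀ {d c} (a : Fin d) (b : Fin c) → remainder {d} c (combine a b) ≡ b
remainder-combine {d} {c} a b = cong proj₂ (Fin.remQuot-combine {d} {c} a b)

⊗-∙ : ∀ {d c} (X X′ : Matrix d) (Y Y′ : Matrix c) → (X ⊗ Y) ∙ (X′ ⊗ Y′) ≋ (X ∙ X′) ⊗ (Y ∙ Y′)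
⊗-∙ {d} {c} X X′ Y Y′ e e′ = begin
  ((X ⊗ Y) ∙ (X′ ⊗ Y′)) e e′
    ≡⟨ fold-combine ℤ.+-0-monoid d (λ k → (X ⊗ Y) e k * (X′ ⊗ Y′) k e′) ⟩
  ∑[ a < d ] ∑[ b < c ] ((X ⊗ Y) e (combine a b) * (X′ ⊗ Y′) (combine a b) e′)
    ≡⟨ sum-cong-≗ (λ a → sum-cong-≗ (λ b → term a b)) ⟩
  ∑[ a < d ] ∑[ b < c ] (X q a * X′ a q′ * (Y r b * Y′ b r′))
    ≡⟨ sum-cong-≗ (λ a → *-distribˡ-sum (X q a * X′ a q′) (λ b → Y r b * Y′ b r′)) ⟨
  ∑[ a < d ] (X q a * X′ a q′ * (Y ∙ Y′) r r′)
    ≡⟨ *-distribʳ-sum ((Y ∙ Y′) r r′) (λ a → X q a * X′ a q′) ⟨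
  (X ∙ X′) q q′ * (Y ∙ Y′) r r′
    ∎
  where
  q q′ : Fin d
  q = quotient c e
  q′ = quotient c e′
  r r′ : Fin c
  r = remainder {d} c e
  r′ = remainder {d} c e′
  interchange : ∀ x y x′ y′ → x * y * (x′ * y′) ≡ x * x′ * (y * y′)
  interchange = solve-∀
  term : ∀ a b → (X ⊗ Y) e (combine a b) * (X′ ⊗ Y′) (combine a b) e′ ≡ X q a * X′ a q′ * (Y r b * Y′ b r′)
  term a b = begin
    (X ⊗ Y) e (combine a b) * (X′ ⊗ Y′) (combine a b) e′
      ≡⟨ cong₂ (λ a′ b′ → X q a′ * Y r b′ * (X′ a′ q′ * Y′ b′ r′)) (quotient-combine a b) (remainder-combine a b) ⟩
    X q a * Y r b * (X′ a q′ * Y′ b r′)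
      ≡⟨ interchange (X q a) (Y r b) (X′ a q′) (Y′ b r′) ⟩
    X q a * X′ a q′ * (Y r b * Y′ b r′)
      ∎

combine-<-lex : ∀ {d c} {a a′ : Fin d} {b b′ : Fin c} →
                combine a b Fin.< combine a′ b′ → a Fin.< a′ ⊎ (a ≡ a′ × b Fin.< b′)
combine-<-lex {c = c} {a} {a′} {b} {b′} lt with Fin.<-cmp a a′
... | tri< a<a′ _ _ = inj₁ a<a′
... | tri≈ _ refl _ = inj₂ (refl , ℕ.+-cancelˡ-< (c ℕ.* toℕ a) (toℕ b) (toℕ b′)
                                     (subst₂ ℕ._<_ (Fin.toℕ-combine a b) (Fin.toℕ-combine a b′) lt))
... | tri> _ _ a′<a = contradiction lt (ℕ.<-asym (Fin.combine-monoˡ-< b′ b a′<a))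

<-lex : ∀ {d c} {e e′ : Fin (d ℕ.* c)} → e Fin.< e′ →
        quotient {d} c e Fin.< quotient {d} c e′
          ⊎ (quotient {d} c e ≡ quotient {d} c e′ × remainder {d} c e Fin.< remainder {d} c e′)
<-lex {d} {c} {e} {e′} lt =
  combine-<-lex (subst₂ Fin._<_ (sym (Fin.combine-remQuot {d} c e)) (sym (Fin.combine-remQuot {d} c e′)) lt)

⊗-zero : ∀ {d c} (X : Matrix d) (Y : Matrix c) {a a′ b b′} →
         X a a′ ≡ 0ℤ ⊎ (a ≡ a′ × Y b b′ ≡ 0ℤ) → X a a′ * Y b b′ ≡ 0ℤ
⊗-zero X Y {b = b} {b′} (inj₁ X≡0) = trans (cong (_* Y b b′) X≡0) (ℤ.*-zeroˡ (Y b b′))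
⊗-zero X Y {a = a} {a′} (inj₂ (_ , Y≡0)) = trans (cong (X a a′ *_) Y≡0) (ℤ.*-zeroʳ (X a a′))

⊗-upper : ∀ {d c} (X : Matrix d) (Y : Matrix c) → UpperTriangular X → UpperTriangular Y → UpperTriangular (X ⊗ Y)
⊗-upper {d} {c} X Y X-upper Y-upper e e′ e′<e with <-lex {d} {c} e′<e
... | inj₁ q′<q           = ⊗-zero X Y (inj₁ (X-upper _ _ q′<q))
... | inj₂ (q′≡q , r′<r)  = ⊗-zero X Y (inj₂ (sym q′≡q , Y-upper _ _ r′<r))

⊗-lower : ∀ {d c} (X : Matrix d) (Y : Matrix c) → LowerTriangular X → LowerTriangular Y → LowerTriangular (X ⊗ Y)
⊗-lower {d} {c} X Y X-lower Y-lower e e′ e<e′ with <-lex {d} {c} e<e′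
... | inj₁ q<q′           = ⊗-zero X Y (inj₁ (X-lower _ _ q<q′))
... | inj₂ (q≡q′ , r<r′)  = ⊗-zero X Y (inj₂ (q≡q′ , Y-lower _ _ r<r′))

Eigenrows-⊗ : ∀ {d c} {F X : Matrix d} {G Y : Matrix c} {μ : Fin d → ℤ} {ν : Fin c → ℤ} →
              Eigenrows F X μ → Eigenrows G Y ν →
              Eigenrows (F ⊗ G) (X ⊗ Y) (λ e → μ (quotient c e) * ν (remainder {d} c e))
Eigenrows-⊗ {d} {c} {F} {X} {G} {Y} {μ} {ν} (eigenrows F-eigen) (eigenrows G-eigen) = eigenrows λ e e′ → begin
  ((F ⊗ G) ∙ (X ⊗ Y)) e e′
    ≡⟨ ⊗-∙ F X G Y e e′ ⟩
  (F ∙ X) (q e) (q e′) * (G ∙ Y) (r e) (r e′)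
    ≡⟨ cong₂ _*_ (F-eigen (q e) (q e′)) (G-eigen (r e) (r e′)) ⟩
  μ (q e) * F (q e) (q e′) * (ν (r e) * G (r e) (r e′))
    ≡⟨ interchange (μ (q e)) (F (q e) (q e′)) (ν (r e)) (G (r e) (r e′)) ⟩
  μ (q e) * ν (r e) * (F ⊗ G) e e′ ∎
  where
  q : Fin (d ℕ.* c) → Fin d
  q = quotient c
  r : Fin (d ℕ.* c) → Fin c
  r = remainder {d} c
  interchange : ∀ x y x′ y′ → x * y * (x′ * y′) ≡ x * x′ * (y * y′)
  interchange = solve-∀

-- The complete graph

J-I : Matrix m
J-I a a′ = 1ℤ - δ a a′

eigenvalue : Fin m → ℤ
eigenvalue {suc m} zero    = + m
eigenvalue         (suc _) = -1ℤ

-- Rows: the all-ones vector, a left eigenvector of J − I for m − 1, and the vectors e_a − e_0, which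
-- have coordinate sum 0 and so are left eigenvectors for −1.
eigenbasis : Matrix m
eigenbasis zero    _  = 1ℤ
eigenbasis (suc a) a′ = δ (suc a) a′ - δ zero a′

upperFactor : Matrix m
upperFactor {suc m} zero    zero    = + suc m
upperFactor         zero    (suc _) = 1ℤ
upperFactor         (suc a) a′      = δ (suc a) a′

lowerFactor : Matrix m
lowerFactor zero    a′ = δ zero a′
lowerFactor (suc a) a′ = eigenbasis (suc a) a′

∙-J-I : ∀ {l} (A : Fin l → Fin m → ℤ) i j → (A ∙ J-I) i j ≡ sum (A i) - A i j
∙-J-I {m} A i j = begin
  ∑[ k < m ] (A i k * (1ℤ - δ k j))
    ≡⟨ sum-cong-≗ (λ k → expand (A i k) (δ k j)) ⟩
  ∑[ k < m ] (A i k + - (A i k * δ k j))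
    ≡⟨ ∑-distrib-+ (A i) (λ k → - (A i k * δ k j)) ⟩
  sum (A i) + ∑[ k < m ] (- (A i k * δ k j))
    ≡⟨ cong (λ s → sum (A i) + s) (trans (sum-neg (λ k → A i k * δ k j)) (cong -_ (sum-δʳ j (A i)))) ⟩
  sum (A i) - A i j ∎
  where
  expand : ∀ a d → a * (1ℤ - d) ≡ a + - (a * d)
  expand = solve-∀

eigenbasis-∙-J-I : eigenbasis {m} ∙ J-I ≋ λ a a′ → eigenvalue a * eigenbasis a a′
eigenbasis-∙-J-I {suc m} zero a′ = begin
  (eigenbasis ∙ J-I) zero a′   ≡⟨ ∙-J-I (eigenbasis {suc m}) zero a′ ⟩
  ∑[ k < suc m ] 1ℤ - 1ℤ       ≡⟨ cong (_- 1ℤ) (sum-const (suc m) 1ℤ) ⟩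
  + suc m * 1ℤ - 1ℤ            ≡⟨ shift (+ m) ⟩
  + m * 1ℤ                     ∎
  where
  shift : ∀ x → (1ℤ + x) * 1ℤ - 1ℤ ≡ x * 1ℤ
  shift = solve-∀
eigenbasis-∙-J-I {suc m} (suc a) a′ = begin
  (eigenbasis ∙ J-I) (suc a) a′
    ≡⟨ ∙-J-I (eigenbasis {suc m}) (suc a) a′ ⟩
  sum (λ k → δ (suc a) k - δ zero k) - eigenbasis (suc a) a′
    ≡⟨ cong (_- eigenbasis (suc a) a′) coordinate-sum ⟩
  0ℤ - eigenbasis (suc a) a′
    ≡⟨ ℤ.+-identityˡ _ ⟩
  - eigenbasis (suc a) a′
    ≡⟨ ℤ.-1*i≡-i _ ⟨
  -1ℤ * eigenbasis (suc a) a′ ∎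
  where
  coordinate-sum : sum (λ k → δ (suc a) k - δ zero k) ≡ 0ℤ
  coordinate-sum = trans (∑-distrib-+ (δ (suc a)) (λ k → - δ zero k))
                         (cong₂ _+_ (sum-δ-row (suc a)) (trans (sum-neg (δ {suc m} zero)) (cong -_ (sum-δ-row {suc m} zero))))

upper∙lower : upperFactor {m} ∙ lowerFactor ≋ eigenbasis
upper∙lower (suc a) a′ = sum-δˡ (suc a) (λ k → lowerFactor k a′)
upper∙lower {suc m} zero zero = begin
  + suc m * 1ℤ + ∑[ k < m ] (1ℤ * (0ℤ - 1ℤ))   ≡⟨ cong (λ s → + suc m * 1ℤ + s) (sum-const m -1ℤ) ⟩
  + suc m * 1ℤ + + m * -1ℤ                      ≡⟨ cancel (+ m) ⟩
  1ℤ                                             ∎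
  where
  cancel : ∀ x → (1ℤ + x) * 1ℤ + x * -1ℤ ≡ 1ℤ
  cancel = solve-∀
upper∙lower {suc m} zero (suc a′) = begin
  + suc m * 0ℤ + ∑[ k < m ] (1ℤ * (δ (suc k) (suc a′) - 0ℤ))
    ≡⟨ cong₂ _+_ (ℤ.*-zeroʳ (+ suc m)) (sum-cong-≗ drop-suc) ⟩
  0ℤ + ∑[ k < m ] δ k a′
    ≡⟨ trans (ℤ.+-identityˡ _) (sum-δ-column a′) ⟩
  1ℤ ∎
  where
  drop-suc : ∀ k → 1ℤ * (δ (suc k) (suc a′) - 0ℤ) ≡ δ k a′
  drop-suc k = trans (ℤ.*-identityˡ _) (trans (ℤ.+-identityʳ _) (δ-injective Fin.suc-injective k a′))

upperFactor-upper : UpperTriangular (upperFactor {m})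
upperFactor-upper zero    k ()
upperFactor-upper (suc a) k k<a = δ-≢ (Fin.<⇒≢ k<a ∘ sym)

upperFactor-diagonal : (a : Fin m) → upperFactor a a ≢ 0ℤ
upperFactor-diagonal {suc m} zero ()
upperFactor-diagonal (suc a) eq = contradiction (trans (sym (δ-diag (suc a))) eq) λ ()

lowerFactor-lower : LowerTriangular (lowerFactor {m})
lowerFactor-lower zero    k 0<k = δ-≢ (Fin.<⇒≢ 0<k)
lowerFactor-lower (suc a) k a<k = cong₂ _-_ (δ-≢ (Fin.<⇒≢ a<k)) (δ-≢ (Fin.<⇒≢ (ℕ.<-trans ℕ.z<s a<k)))

lowerFactor-diagonal : (a : Fin m) → lowerFactor a a ≡ 1ℤ
lowerFactor-diagonal zero    = refl
lowerFactor-diagonal (suc a) = cong (_- 0ℤ) (δ-diag (suc a))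

det-charMat-J-I⊗J-I : ∀ d c y →
  det (charMat y (J-I {d} ⊗ J-I {c})) ≡ ∏ (λ e → y - eigenvalue (quotient {d} c e) * eigenvalue (remainder {d} c e))
det-charMat-J-I⊗J-I d c y = det-eigenrows U L (charMat y (J-I {d} ⊗ J-I {c})) μ
    (⊗-upper (upperFactor {d}) (upperFactor {c}) upperFactor-upper upperFactor-upper)
    (λ e eq → [ upperFactor-diagonal (quotient {d} c e) , upperFactor-diagonal (remainder {d} c e) ]′ (ℤ.i*j≡0⇒i≡0∨j≡0 _ eq))
    (⊗-lower (lowerFactor {d}) (lowerFactor {c}) lowerFactor-lower lowerFactor-lower)
    (λ e → cong₂ _*_ (lowerFactor-diagonal (quotient {d} c e)) (lowerFactor-diagonal (remainder {d} c e)))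
    (Eigenrows-cong (λ e e′ → sym (⊗-∙ {d} {c} upperFactor lowerFactor upperFactor lowerFactor e e′))
                    (Eigenrows-charMat y (Eigenrows-⊗ {d} {c} Eigenrows-J-I Eigenrows-J-I)))
  where
  U L : Matrix (d ℕ.* c)
  U = upperFactor {d} ⊗ upperFactor {c}
  L = lowerFactor {d} ⊗ lowerFactor {c}
  μ : Fin (d ℕ.* c) → ℤ
  μ e = y - eigenvalue (quotient {d} c e) * eigenvalue (remainder {d} c e)
  Eigenrows-J-I : ∀ {m} → Eigenrows (upperFactor {m} ∙ lowerFactor) J-I eigenvalue
  Eigenrows-J-I = Eigenrows-cong (λ i j → sym (upper∙lower i j)) (eigenrows eigenbasis-∙-J-I)

∏-eigenvalues : ∀ d c y →
  ∏ (λ e → y - eigenvalue (quotient {suc d} (suc c) e) * eigenvalue (remainder {suc d} (suc c) e))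
    ≡ (y - 1ℤ) ^ (c ℕ.* d) * (y + + c) ^ d * (y + + d) ^ c * (y - + (c ℕ.* d))
∏-eigenvalues d c y = begin
  ∏ (λ e → g (q e) (r e))
    ≡⟨ fold-combine ℤ.*-1-monoid (suc d) (λ e → g (q e) (r e)) ⟩
  ∏ {suc d} (λ a → ∏ {suc c} (λ b → g (q (combine a b)) (r (combine a b))))
    ≡⟨ ∏-cong (λ a → ∏-cong (λ b → cong₂ g (quotient-combine a b) (remainder-combine a b))) ⟩
  ∏ {suc d} (λ a → ∏ {suc c} (λ b → g a b))
    ≡⟨⟩ -- split off a = 0 and b = 0, the indices of the eigenvalues d and c
  (y - + d * + c) * ∏ {c} (λ _ → y - + d * - 1ℤ) * ∏ {d} (λ _ → (y - - 1ℤ * + c) * ∏ {c} (λ _ → y - - 1ℤ * - 1ℤ))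
    ≡⟨ cong₂ _*_ first-row (∏-cong {d} (λ _ → other-row)) ⟩
  (y - + (c ℕ.* d)) * (y + + d) ^ c * ∏ {d} (λ _ → (y + + c) * (y - 1ℤ) ^ c)
    ≡⟨ cong (λ z → (y - + (c ℕ.* d)) * (y + + d) ^ c * z)
            (trans (∏-distrib-* {d} (λ _ → y + + c) (λ _ → (y - 1ℤ) ^ c))
                   (cong₂ _*_ (∏-const d (y + + c)) (trans (∏-const d ((y - 1ℤ) ^ c)) (ℤ.^-*-assoc (y - 1ℤ) c d)))) ⟩
  (y - + (c ℕ.* d)) * (y + + d) ^ c * ((y + + c) ^ d * (y - 1ℤ) ^ (c ℕ.* d))
    ≡⟨ rearrange ((y - 1ℤ) ^ (c ℕ.* d)) ((y + + c) ^ d) ((y + + d) ^ c) (y - + (c ℕ.* d)) ⟩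
  (y - 1ℤ) ^ (c ℕ.* d) * (y + + c) ^ d * (y + + d) ^ c * (y - + (c ℕ.* d))
    ∎
  where
  q : Fin (suc d ℕ.* suc c) → Fin (suc d)
  q = quotient (suc c)
  r : Fin (suc d ℕ.* suc c) → Fin (suc c)
  r = remainder {suc d} (suc c)
  g : Fin (suc d) → Fin (suc c) → ℤ
  g a b = y - eigenvalue a * eigenvalue b
  plus-d : ∀ y x → y - x * - 1ℤ ≡ y + x
  plus-d = solve-∀
  plus-c : ∀ y x → y - - 1ℤ * x ≡ y + x
  plus-c = solve-∀
  minus-1 : ∀ y → y - - 1ℤ * - 1ℤ ≡ y - 1ℤ
  minus-1 = solve-∀
  rearrange : ∀ a b c e → e * c * (b * a) ≡ a * b * c * e
  rearrange = solve-∀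
  first-row : (y - + d * + c) * ∏ {c} (λ _ → y - + d * - 1ℤ) ≡ (y - + (c ℕ.* d)) * (y + + d) ^ c
  first-row = cong₂ _*_ (cong (λ z → y - z) (trans (ℤ.*-comm (+ d) (+ c)) (sym (ℤ.pos-* c d))))
                        (trans (∏-const c (y - + d * - 1ℤ)) (cong (_^ c) (plus-d y (+ d))))
  other-row : (y - - 1ℤ * + c) * ∏ {c} (λ _ → y - - 1ℤ * - 1ℤ) ≡ (y + + c) * (y - 1ℤ) ^ c
  other-row = cong₂ _*_ (plus-c y (+ c)) (trans (∏-const c (y - - 1ℤ * - 1ℤ)) (cong (_^ c) (minus-1 y)))

-- The non-backtracking matrix of K_{d,c}

nbEntry : ∀ {d c} → Vertex d c × Vertex d c → Vertex d c × Vertex d c → ℤ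
nbEntry (i , j) (k , l) with j ≟V k | i ≟V l
... | yes _ | no  _ = 1ℤ
... | yes _ | yes _ = 0ℤ
... | no  _ | _     = 0ℤ

nbMatrix-arc : ∀ d c e f → nbMatrix d c e f ≡ nbEntry (arc d c e) (arc d c f)
nbMatrix-arc d c e f with arc d c e | arc d c f
... | (i , j) | (k , l) with j ≟V k | i ≟V l
... | yes _ | no  _ = refl
... | yes _ | yes _ = refl
... | no  _ | _     = refl

nbEntry-lr-rl : ∀ {d c} (a a′ : Fin d) (b b′ : Fin c) → nbEntry (inj₁ a , inj₂ b) (inj₂ b′ , inj₁ a′) ≡ J-I a a′ * δ b b′
nbEntry-lr-rl a a′ b b′ with b Fin.≟ b′ | a Fin.≟ a′
... | yes _ | yes _ = refl
... | yes _ | no  _ = refl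
... | no  _ | yes _ = refl
... | no  _ | no  _ = refl

nbEntry-rl-lr : ∀ {d c} (a a′ : Fin d) (b b′ : Fin c) → nbEntry (inj₂ b , inj₁ a) (inj₁ a′ , inj₂ b′) ≡ δ a a′ * J-I b b′
nbEntry-rl-lr a a′ b b′ with a Fin.≟ a′ | b Fin.≟ b′
... | yes _ | yes _ = refl
... | yes _ | no  _ = refl
... | no  _ | yes _ = refl
... | no  _ | no  _ = refl

module _ (d c : ℕ) where

  private
    dc : ℕ
    dc = d ℕ.* c

    -- Fin (2 * dc) unfolds to Fin (dc + (dc + 0)); the right-to-left arcs are the second summand.
    down : Fin (dc ℕ.+ 0) → Fin dc
    down = remainder {1} dc

  arc-lr : ∀ e → arc d c (e ↑ˡ (dc ℕ.+ 0)) ≡ (inj₁ (quotient c e) , inj₂ (remainder {d} c e))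
  arc-lr e rewrite Fin.splitAt-↑ˡ dc e (dc ℕ.+ 0) = refl

  arc-rl : ∀ j → arc d c (dc ↑ʳ j) ≡ (inj₂ (remainder {d} c (down j)) , inj₁ (quotient c (down j)))
  arc-rl j rewrite Fin.splitAt-↑ʳ dc (dc ℕ.+ 0) j = refl

  P : Fin dc → Fin (dc ℕ.+ 0) → ℤ
  P e j = (J-I {d} ⊗ δ {c}) e (down j)

  Q : Fin (dc ℕ.+ 0) → Fin dc → ℤ
  Q j e = (δ {d} ⊗ J-I {c}) (down j) e

  nbMatrix-blocks : nbMatrix d c ≋ blocks O P Q O
  nbMatrix-blocks = blockwise (λ k l → nbMatrix d c k l ≡ blocks O P Q O k l)
    (λ e e′ → entry (e ↑ˡ _) (e′ ↑ˡ _) (trans (cong₂ nbEntry (arc-lr e) (arc-lr e′)) (sym (blocks-↑ˡ↑ˡ O P Q O e e′))))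
    (λ e j → entry (e ↑ˡ _) (dc ↑ʳ j) (trans (cong₂ nbEntry (arc-lr e) (arc-rl j))
                   (trans (nbEntry-lr-rl {d} {c} _ _ _ _) (sym (blocks-↑ˡ↑ʳ O P Q O e j)))))
    (λ j e → entry (dc ↑ʳ j) (e ↑ˡ _) (trans (cong₂ nbEntry (arc-rl j) (arc-lr e))
                   (trans (nbEntry-rl-lr {d} {c} _ _ _ _) (sym (blocks-↑ʳ↑ˡ O P Q O j e)))))
    (λ j j′ → entry (dc ↑ʳ j) (dc ↑ʳ j′) (trans (cong₂ nbEntry (arc-rl j) (arc-rl j′)) (sym (blocks-↑ʳ↑ʳ O P Q O j j′))))
    where
    entry : ∀ k l {v} → nbEntry (arc d c k) (arc d c l) ≡ v → nbMatrix d c k l ≡ v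
    entry k l = trans (nbMatrix-arc d c k l)

  sum-down : (f : Fin dc → ℤ) → ∑[ j < dc ℕ.+ 0 ] f (down j) ≡ sum f
  sum-down f = begin
    ∑[ j < dc ℕ.+ 0 ] f (down j)
      ≡⟨ fold-combine ℤ.+-0-monoid 1 {dc} (f ∘ down) ⟩
    ∑[ b < dc ] f (down (combine {1} zero b)) + 0ℤ
      ≡⟨ ℤ.+-identityʳ _ ⟩
    ∑[ b < dc ] f (down (combine {1} zero b))
      ≡⟨ sum-cong-≗ (λ b → cong f (remainder-combine {1} {dc} zero b)) ⟩
    sum f ∎

  P∙Q : P ∙ Q ≋ J-I {d} ⊗ J-I {c}
  P∙Q e e′ = begin
    (P ∙ Q) e e′
      ≡⟨ sum-down (λ k → (J-I {d} ⊗ δ {c}) e k * (δ {d} ⊗ J-I {c}) k e′) ⟩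
    ((J-I {d} ⊗ δ {c}) ∙ (δ {d} ⊗ J-I {c})) e e′
      ≡⟨ ⊗-∙ {d} {c} J-I δ δ J-I e e′ ⟩
    ((J-I {d} ∙ δ) ⊗ (δ {c} ∙ J-I)) e e′
      ≡⟨ cong₂ _*_ (sum-δʳ q′ (J-I q)) (sum-δˡ r (λ k → J-I k r′)) ⟩
    (J-I {d} ⊗ J-I {c}) e e′ ∎
    where
    q q′ : Fin d
    q = quotient {d} c e
    q′ = quotient {d} c e′
    r r′ : Fin c
    r = remainder {d} c e
    r′ = remainder {d} c e′

  charPolyNB-≢0 : (x : ℤ) → x ≢ 0ℤ → charPolyNB d c x ≡ det (charMat (x * x) (J-I {d} ⊗ J-I {c}))
  charPolyNB-≢0 x x≢0 = ℤ.*-cancelˡ-≡ (x ^ dc) _ _ {{ℤ.≢-nonZero (x≢0 ∘ ℤ.i^n≡0⇒i≡0 x dc)}} (begin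
    x ^ dc * det (charMat x (nbMatrix d c))
      ≡⟨ cong (x ^ dc *_) (det-cong (charMat-cong x nbMatrix-blocks)) ⟩
    x ^ dc * det (charMat x (blocks O P Q O))
      ≡⟨ det-charMat-bipartite x P Q ⟩
    x ^ (dc ℕ.+ 0) * det (charMat (x * x) (P ∙ Q))
      ≡⟨ cong₂ (λ k D → x ^ k * D) (ℕ.+-identityʳ dc) (det-cong (charMat-cong (x * x) P∙Q)) ⟩
    x ^ dc * det (charMat (x * x) (J-I {d} ⊗ J-I {c}))  ∎)

-- Congruences modulo x

infix 4 _≡_mod_
record _≡_mod_ (a b m : ℤ) : Set where
  constructor congruent
  field divides-difference : m ∣ a - b

≡-mod-refl : ∀ {m} a → a ≡ a mod m
≡-mod-refl {m} a = congruent (divides 0ℤ (trans (ℤ.+-inverseʳ a) (sym (ℤ.*-zeroˡ m))))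

+-mod : ∀ {m a b a′ b′} → a ≡ b mod m → a′ ≡ b′ mod m → a + a′ ≡ b + b′ mod m
+-mod {m} {a} {b} {a′} {b′} (congruent a≡b) (congruent a′≡b′) =
  congruent (subst (m ∣_) (regroup a b a′ b′) (∣m∣n⇒∣m+n a≡b a′≡b′))
  where
  regroup : ∀ a b a′ b′ → (a - b) + (a′ - b′) ≡ (a + a′) - (b + b′)
  regroup = solve-∀

*-mod : ∀ {m a b a′ b′} → a ≡ b mod m → a′ ≡ b′ mod m → a * a′ ≡ b * b′ mod m
*-mod {m} {a} {b} {a′} {b′} (congruent a≡b) (congruent a′≡b′) =
  congruent (subst (m ∣_) (regroup a b a′ b′) (∣m∣n⇒∣m+n (∣n⇒∣m*n a a′≡b′) (∣m⇒∣m*n b′ a≡b)))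
  where
  regroup : ∀ a b a′ b′ → a * (a′ - b′) + (a - b) * b′ ≡ a * a′ - b * b′
  regroup = solve-∀

^-mod : ∀ {m a b} → a ≡ b mod m → ∀ k → a ^ k ≡ b ^ k mod m
^-mod a≡b zero    = ≡-mod-refl 1ℤ
^-mod a≡b (suc k) = *-mod a≡b (^-mod a≡b k)

sum-mod : ∀ {m} {f g : Fin n → ℤ} → (∀ i → f i ≡ g i mod m) → sum f ≡ sum g mod m
sum-mod {zero}  _   = ≡-mod-refl 0ℤ
sum-mod {suc n} f≡g = +-mod (f≡g zero) (sum-mod (f≡g ∘ suc))

det-mod : ∀ {m} {A B : Matrix n} → (∀ i j → A i j ≡ B i j mod m) → det A ≡ det B mod m
det-mod {zero}      _   = ≡-mod-refl 1ℤ
det-mod {suc n} {m} {A} {B} A≡B = subst₂ (λ a b → a ≡ b mod m) (sym (det-expand A)) (sym (det-expand B))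
  (sum-mod (λ j → *-mod (*-mod (≡-mod-refl (sign (toℕ j))) (A≡B zero j)) (det-mod (λ r s → A≡B (suc r) (punchIn j s)))))

x≡0-mod-x : ∀ x → x ≡ 0ℤ mod x
x≡0-mod-x x = congruent (divides 1ℤ (trans (ℤ.+-identityʳ x) (sym (ℤ.*-identityˡ x))))

charMat-mod : ∀ x (M : Matrix n) i j → charMat x M i j ≡ charMat 0ℤ M i j mod x
charMat-mod x M i j = subst₂ (λ a b → a ≡ b mod x) (sym (charMat-≡ x M i j)) (sym (charMat-≡ 0ℤ M i j))
  (+-mod (*-mod (x≡0-mod-x x) (≡-mod-refl (δ i j))) (≡-mod-refl (- M i j)))

-- At x = 0, evaluate at x = 1 + |D| for D = f 0 − g 0: then x divides D, which forces D = 0.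
extend-to-0 : (f g : ℤ → ℤ) → (∀ x → f x ≡ f 0ℤ mod x) → (∀ x → g x ≡ g 0ℤ mod x) →
              (∀ x → x ≢ 0ℤ → f x ≡ g x) → ∀ x → f x ≡ g x
extend-to-0 f g f-mod g-mod agree x with x ℤ.≟ 0ℤ
... | no  x≢0 = agree x x≢0
... | yes refl = ℤ.i-j≡0⇒i≡j (f 0ℤ) (g 0ℤ) (ℤ.∣i∣≡0⇒i≡0 (bound ℤ.∣ D ∣ (∣⇒∣ᵤ X∣D)))
  where
  open _≡_mod_
  D X : ℤ
  D = f 0ℤ - g 0ℤ
  X = + suc ℤ.∣ D ∣
  cancel : ∀ a b e → (a - b) - (a - e) ≡ e - b
  cancel = solve-∀
  X∣D : X ∣ D
  X∣D = subst (X ∣_) (trans (cong (λ z → (g X - g 0ℤ) - (z - f 0ℤ)) (agree X λ ())) (cancel (g X) (g 0ℤ) (f 0ℤ)))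
              (∣m∣n⇒∣m-n (divides-difference (g-mod X)) (divides-difference (f-mod X)))
  bound : ∀ k → suc k ∣ℕ k → k ≡ 0
  bound zero    _ = refl
  bound (suc k) h = contradiction h (>⇒∤ (ℕ.n<1+n (suc k)))

charPolyFormula : ℕ → ℕ → ℤ → ℤ
charPolyFormula d c x =
  ((x * x - + 1) ^ ((c ∸ 1) *ℕ (d ∸ 1)))
  * ((x * x + + (c ∸ 1)) ^ (d ∸ 1))
  * ((x * x + + (d ∸ 1)) ^ (c ∸ 1))
  * (x * x - + ((c ∸ 1) *ℕ (d ∸ 1)))

charPolyFormula-mod : ∀ d c x → charPolyFormula d c x ≡ charPolyFormula d c 0ℤ mod x
charPolyFormula-mod d c x =
  *-mod (*-mod (*-mod (^-mod (shift (- + 1)) ((c ∸ 1) *ℕ (d ∸ 1)))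
                      (^-mod (shift (+ (c ∸ 1))) (d ∸ 1)))
               (^-mod (shift (+ (d ∸ 1))) (c ∸ 1)))
        (shift (- + ((c ∸ 1) *ℕ (d ∸ 1))))
  where
  shift : ∀ k → x * x + k ≡ 0ℤ * 0ℤ + k mod x
  shift k = +-mod (*-mod (x≡0-mod-x x) (x≡0-mod-x x)) (≡-mod-refl k)

charPolyNB-formula : ∀ d c (x : ℤ) → charPolyNB (suc d) (suc c) x ≡ charPolyFormula (suc d) (suc c) x
charPolyNB-formula d c = extend-to-0 (charPolyNB (suc d) (suc c)) (charPolyFormula (suc d) (suc c))
  (λ x → det-mod {A = charMat x (nbMatrix (suc d) (suc c))} {B = charMat 0ℤ (nbMatrix (suc d) (suc c))}
                   (charMat-mod x (nbMatrix (suc d) (suc c))))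
  (charPolyFormula-mod (suc d) (suc c))
  (λ x x≢0 → begin
    charPolyNB (suc d) (suc c) x                          ≡⟨ charPolyNB-≢0 (suc d) (suc c) x x≢0 ⟩
    det (charMat (x * x) (J-I {suc d} ⊗ J-I {suc c}))     ≡⟨ det-charMat-J-I⊗J-I (suc d) (suc c) (x * x) ⟩
    _                                                     ≡⟨ ∏-eigenvalues d c (x * x) ⟩
    charPolyFormula (suc d) (suc c) x                     ∎)

proposition3p3 : (d c : ℕ) → c ≤ d → 2 ≤ c → d ≢ 2 →
    (x : ℤ) →
      charPolyNB d c x ≡
        ((x * x - + 1) ^ ((c ∸ 1) *ℕ (d ∸ 1)))
        * ((x * x + + (c ∸ 1)) ^ (d ∸ 1))
        * ((x * x + + (d ∸ 1)) ^ (c ∸ 1))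
        * (x * x - + ((c ∸ 1) *ℕ (d ∸ 1)))
proposition3p3 (suc d) (suc c) _ _ _ = charPolyNB-formula d c
proposition3p3 zero    (suc c) () _ _
proposition3p3 _       zero    _ () _
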